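{- Let $h\in\mathbb{Z}[x,y,z]$ be a (possibly zero) homogeneous polynomial of degree 6, and let $X_h$ be the hypersurface over $\mathbb{Q}$ in the weighted projective space $\mathbb{P}(1,1,1,3)=\operatorname{Proj}\mathbb{Q}[x,y,z,w]$ given by \[73w^2 = 7\big(F_0(x,y,z)+15h(x,y,z)\big),\] where \[ \begin{aligned} F_0={}&11x^5y+7x^5z+x^4y^2+5x^4yz+7x^4z^2+7x^3y^3+10x^3y^2z+5x^3yz^2+4x^3z^3\\ &+6x^2y^4+5x^2y^3z+10x^2y^2z^2+5x^2yz^3+5x^2z^4+11xy^5+5xy^3z^2+12xz^5\\ &+9y^6+5y^4z^2+10y^2z^4+4z^6. \end{aligned} \] Then $X_h$ is a K3 surface over $\mathbb{Q}$ of degree 2.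
   Context: A K3 surface of degree 2 over a field $k$ is a hypersurface in $\mathbb{P}(1,1,1,3)$ over $k$ given by $w^2=f(x,y,z)$ with $f$ homogeneous of degree 6 such that the plane curve $V(f)$ is smooth (equivalently, the double cover of $\mathbb{P}^2$ branched along $V(f)$ is smooth). -}

module Defs where

open import Level using (0ℓ)
open import Data.Nat as ℕ using (ℕ; zero; suc; _∸_)
open import Data.Integer as ℤ using (ℤ; +_; -[1+_])
open import Data.List using (List; []; _∷_; map; _++_)
open import Data.List.Relation.Unary.All using (All)
open import Data.Product using (_×_; _,_; ∃)
open import Relation.Nullary using (¬_)
open import Relation.Binary.PropositionalEquality using (_≡_; _≢_)
open import Algebra.Bundles using (CommutativeRing)

-- Polynomials in ℤ[x,y,z], represented as finite lists of terms
-- (coefficient, exponent of x, exponent of y, exponent of z).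
-- The polynomial is the sum of its terms (repetitions allowed).

Term : Set
Term = ℤ × ℕ × ℕ × ℕ

Poly : Set
Poly = List Term

HomTerm : ℕ → Term → Set
HomTerm d (c , a , b , e) = a ℕ.+ b ℕ.+ e ≡ d

IsHomogeneous : ℕ → Poly → Set
IsHomogeneous d f = All (HomTerm d) f

infixr 7 _⋆_
infixr 6 _⊕_

_⋆_ : ℤ → Poly → Poly
k ⋆ f = map (λ { (c , a , b , e) → (k ℤ.* c , a , b , e) }) f

_⊕_ : Poly → Poly → Poly
f ⊕ g = f ++ g

∂x ∂y ∂z : Poly → Poly
∂x = map (λ { (c , a , b , e) → (c ℤ.* (+ a) , a ∸ 1 , b , e) })
∂y = map (λ { (c , a , b , e) → (c ℤ.* (+ b) , a , b ∸ 1 , e) })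
∂z = map (λ { (c , a , b , e) → (c ℤ.* (+ e) , a , b , e ∸ 1) })

-- Fields of characteristic 0 (exactly the fields containing ℚ)

natEmb : (R : CommutativeRing 0ℓ 0ℓ) → ℕ → CommutativeRing.Carrier R
natEmb R zero = CommutativeRing.0# R
natEmb R (suc n) = CommutativeRing._+_ R (CommutativeRing.1# R) (natEmb R n)

record CharZeroField : Set₁ where
  field
    cring : CommutativeRing 0ℓ 0ℓ
  open CommutativeRing cring public
  field
    nontrivial : ¬ (1# ≈ 0#)
    inverse    : ∀ x → ¬ (x ≈ 0#) → ∃ λ y → x * y ≈ 1#
    charZero   : ∀ n → ¬ (natEmb cring (suc n) ≈ 0#)

module _ (K : CharZeroField) where
  open CharZeroField K

  intEmb : ℤ → Carrier
  intEmb (+ n) = natEmb cring n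
  intEmb -[1+ n ] = - natEmb cring (suc n)

  pow : Carrier → ℕ → Carrier
  pow u zero = 1#
  pow u (suc n) = u * pow u n

  evalTerm : Carrier → Carrier → Carrier → Term → Carrier
  evalTerm u v t (c , a , b , e) = intEmb c * (pow u a * (pow v b * pow t e))

  eval : Poly → Carrier → Carrier → Carrier → Carrier
  eval [] u v t = 0#
  eval (m ∷ f) u v t = evalTerm u v t m + eval f u v t

-- The plane curve V(f) is smooth: over every field K of characteristic 0
-- (equivalently over the algebraic closure of ℚ) there is no point
-- [u:v:t] of ℙ² at which f and all its partial derivatives vanish.

SmoothPlaneCurve : Poly → Set₁
SmoothPlaneCurve f =
  (K : CharZeroField) → let open CharZeroField K in
  (u v t : Carrier) → ¬ (u ≈ 0# × v ≈ 0# × t ≈ 0#) →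
  ¬ ( eval K f u v t ≈ 0#
    × eval K (∂x f) u v t ≈ 0#
    × eval K (∂y f) u v t ≈ 0#
    × eval K (∂z f) u v t ≈ 0# )

-- The hypersurface  a·w² = f(x,y,z)  in ℙ(1,1,1,3) over ℚ, with a ∈ ℤ
-- nonzero and f a sextic, is isomorphic over ℚ (via w' = a·w) to
-- w'² = a·f; it is a K3 surface of degree 2 iff f is homogeneous of
-- degree 6 and V(a·f) is a smooth plane curve.
IsK3Degree2 : ℤ → Poly → Set₁
IsK3Degree2 a f = (a ≢ + 0) × IsHomogeneous 6 (a ⋆ f) × SmoothPlaneCurve (a ⋆ f)

F₀ : Poly
F₀ =
    (+ 11 , 5 , 1 , 0) ∷ (+ 7 , 5 , 0 , 1) ∷ (+ 1 , 4 , 2 , 0) ∷ (+ 5 , 4 , 1 , 1)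
  ∷ (+ 7 , 4 , 0 , 2) ∷ (+ 7 , 3 , 3 , 0) ∷ (+ 10 , 3 , 2 , 1) ∷ (+ 5 , 3 , 1 , 2)
  ∷ (+ 4 , 3 , 0 , 3) ∷ (+ 6 , 2 , 4 , 0) ∷ (+ 5 , 2 , 3 , 1) ∷ (+ 10 , 2 , 2 , 2)
  ∷ (+ 5 , 2 , 1 , 3) ∷ (+ 5 , 2 , 0 , 4) ∷ (+ 11 , 1 , 5 , 0) ∷ (+ 5 , 1 , 3 , 2)
  ∷ (+ 12 , 1 , 0 , 5) ∷ (+ 9 , 0 , 6 , 0) ∷ (+ 5 , 0 , 4 , 2) ∷ (+ 10 , 0 , 2 , 4)
  ∷ (+ 4 , 0 , 0 , 6) ∷ []

{-# OPTIONS --safe #-}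
module Submission where

-- Since 15h ≡ 0 (mod 5), the partial derivatives of f = 73·7·(F₀ + 15h) agree modulo 5 with
-- those of F₀′ = 73·7·F₀, and an explicit certificate writes every monomial of degree 13,
-- modulo 5, as a combination of the partials of F₀′ with polynomial coefficients. So at a
-- common zero (u : v : t) of the partials of f over a field of characteristic 0, the values
-- w of the degree-13 monomials satisfy w = 5·C·w for an integer matrix C. As det(I − 5C) ≡ 1
-- (mod 5) is nonzero in characteristic 0 (Nakayama's lemma over ℤ₍₅₎), w = 0, hence
-- u¹³ = v¹³ = t¹³ = 0.

open import Defs
open import Data.Integer using (+_)

open import Level using (0ℓ)
open import Data.Bool using (Bool; true; false; _∧_; T; if_then_else_)
open import Data.Bool.Properties using (T-∧)
open import Data.Integer as ℤ using (ℤ; -[1+_]; 0ℤ; 1ℤ; _⊖_; _◃_)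
import Data.Integer.Properties as ℤ
open import Data.Integer.Divisibility.Signed using (_∣_; divides; _∣?_; ∣m⇒∣m*n; ∣n⇒∣m*n)
import Data.Integer.Tactic.RingSolver as ℤ-Solver
import Data.Nat.Tactic.RingSolver as ℕ-Solver
open import Data.Bool.ListAction using (all; any)
open import Data.List using (List; []; _∷_; [_]; map; _++_; concatMap; foldr; foldl)
open import Data.List.Membership.Propositional using (_∈_)
open import Data.List.Membership.Propositional.Properties using (∈-map⁺; ∈-++⁺ˡ; ∈-++⁺ʳ)
import Data.List.Properties as List
open import Data.List.Relation.Unary.All as All using (All; []; _∷_; all?)
import Data.List.Relation.Unary.All.Properties as All
open import Data.List.Relation.Unary.Any using (here; there)
import Data.List.Relation.Unary.Any.Properties as Any
open import Data.Maybe using (Maybe; just; nothing; maybe)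
open import Data.Nat as ℕ using (ℕ; zero; suc)
import Data.Nat.Properties as ℕ
open import Data.Product using (_×_; _,_; ∃; ∃₂)
import Data.Product.Properties as Product
open import Data.Sign as Sign using ()
open import Data.Sum using (_⊎_; inj₁; inj₂)
open import Data.Unit using (tt)
open import Function using (_∘_)
open import Function.Bundles using (Equivalence)
open import Relation.Binary.Definitions using (DecidableEquality; WeaklyDecidable)
open import Relation.Binary.PropositionalEquality as ≡ using (_≡_; _≢_)
open import Relation.Nullary using (¬_; yes; no; does)
open import Relation.Nullary.Decidable using (⌊_⌋; _×-dec_; _⊎-dec_; toWitness)
open import Relation.Unary using (Decidable)
import Algebra.Properties.CommutativeSemigroup
open import Algebra.Solver.Ring.AlmostCommutativeRing
  using (AlmostCommutativeRing; fromCommutativeRing; _-Raw-AlmostCommutative⟶_; Induced-equivalence)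

module IntegerEmbedding (K : CharZeroField) where
  open CharZeroField K
  open import Algebra.Properties.Ring ring using (-‿involutive; -0#≈0#; -‿distribˡ-*; -‿distribʳ-*)
  open import Algebra.Properties.AbelianGroup +-abelianGroup using (⁻¹-∙-comm)
  open import Algebra.Properties.Monoid.Mult +-monoid using (×-homo-+)
  open import Algebra.Properties.Semiring.Mult semiring using (×1-homo-*) renaming (_×_ to _×′_)
  open import Relation.Binary.Reasoning.Setoid setoid

  ν : ℕ → Carrier
  ν = natEmb cring

  ι : ℤ → Carrier
  ι = intEmb K

  ν≈×1# : ∀ n → ν n ≈ n ×′ 1#
  ν≈×1# zero    = refl
  ν≈×1# (suc n) = +-congˡ (ν≈×1# n)

  ν-+ : ∀ m n → ν (m ℕ.+ n) ≈ ν m + ν n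
  ν-+ m n = begin
    ν (m ℕ.+ n)         ≈⟨ ν≈×1# (m ℕ.+ n) ⟩
    (m ℕ.+ n) ×′ 1#     ≈⟨ ×-homo-+ 1# m n ⟩
    m ×′ 1# + n ×′ 1#   ≈⟨ +-cong (ν≈×1# m) (ν≈×1# n) ⟨
    ν m + ν n           ∎

  ν-* : ∀ m n → ν (m ℕ.* n) ≈ ν m * ν n
  ν-* m n = begin
    ν (m ℕ.* n)         ≈⟨ ν≈×1# (m ℕ.* n) ⟩
    (m ℕ.* n) ×′ 1#     ≈⟨ ×1-homo-* m n ⟩
    m ×′ 1# * (n ×′ 1#) ≈⟨ *-cong (ν≈×1# m) (ν≈×1# n) ⟨
    ν m * ν n           ∎

  1+-cancel-− : ∀ a b → (1# + a) - (1# + b) ≈ a - b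
  1+-cancel-− a b = begin
    (1# + a) + - (1# + b)      ≈⟨ +-congˡ (⁻¹-∙-comm 1# b) ⟨
    (1# + a) + (- 1# + - b)    ≈⟨ +-assoc (1# + a) (- 1#) (- b) ⟨
    ((1# + a) + - 1#) + - b    ≈⟨ +-congʳ (+-congʳ (+-comm 1# a)) ⟩
    ((a + 1#) + - 1#) + - b    ≈⟨ +-congʳ (+-assoc a 1# (- 1#)) ⟩
    (a + (1# + - 1#)) + - b    ≈⟨ +-congʳ (+-congˡ (-‿inverseʳ 1#)) ⟩
    (a + 0#) + - b             ≈⟨ +-congʳ (+-identityʳ a) ⟩
    a - b                      ∎

  ι-⊖ : ∀ m n → ι (m ⊖ n) ≈ ν m - ν n
  ι-⊖ m       zero    = sym (trans (+-congˡ -0#≈0#) (+-identityʳ _))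
  ι-⊖ zero    (suc n) = sym (+-identityˡ _)
  ι-⊖ (suc m) (suc n) = begin
    ι (suc m ⊖ suc n)      ≡⟨ ≡.cong ι (ℤ.[1+m]⊖[1+n]≡m⊖n m n) ⟩
    ι (m ⊖ n)              ≈⟨ ι-⊖ m n ⟩
    ν m - ν n              ≈⟨ 1+-cancel-− (ν m) (ν n) ⟨
    ν (suc m) - ν (suc n)  ∎

  ι-+ : ∀ i j → ι (i ℤ.+ j) ≈ ι i + ι j
  ι-+ (+ m)    (+ n)    = ν-+ m n
  ι-+ (+ m)    -[1+ n ] = ι-⊖ m (suc n)
  ι-+ -[1+ m ] (+ n)    = trans (ι-⊖ n (suc m)) (+-comm _ _)
  ι-+ -[1+ m ] -[1+ n ] = begin
    - ν (suc (suc (m ℕ.+ n)))         ≈⟨ -‿cong (+-congˡ (+-congˡ (ν-+ m n))) ⟩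
    - (1# + (1# + (ν m + ν n)))       ≈⟨ -‿cong (+-congˡ (+-assoc 1# (ν m) (ν n))) ⟨
    - (1# + ((1# + ν m) + ν n))       ≈⟨ -‿cong (+-congˡ (+-congʳ (+-comm 1# (ν m)))) ⟩
    - (1# + ((ν m + 1#) + ν n))       ≈⟨ -‿cong (+-congˡ (+-assoc (ν m) 1# (ν n))) ⟩
    - (1# + (ν m + (1# + ν n)))       ≈⟨ -‿cong (+-assoc 1# (ν m) (1# + ν n)) ⟨
    - ((1# + ν m) + (1# + ν n))       ≈⟨ ⁻¹-∙-comm (1# + ν m) (1# + ν n) ⟨
    - (1# + ν m) + - (1# + ν n)       ∎

  ι-neg : ∀ i → ι (ℤ.- i) ≈ - ι i
  ι-neg (+ zero)  = sym -0#≈0#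
  ι-neg (+ suc n) = refl
  ι-neg -[1+ n ]  = sym (-‿involutive _)

  ι-◃⁺ : ∀ n → ι (Sign.+ ◃ n) ≈ ν n
  ι-◃⁺ zero    = refl
  ι-◃⁺ (suc n) = refl

  ι-◃⁻ : ∀ n → ι (Sign.- ◃ n) ≈ - ν n
  ι-◃⁻ zero    = sym -0#≈0#
  ι-◃⁻ (suc n) = refl

  ι-* : ∀ i j → ι (i ℤ.* j) ≈ ι i * ι j
  ι-* (+ m)    (+ n)    = trans (ι-◃⁺ (m ℕ.* n)) (ν-* m n)
  ι-* (+ m)    -[1+ n ] = trans (ι-◃⁻ (m ℕ.* suc n)) (trans (-‿cong (ν-* m (suc n))) (-‿distribʳ-* _ _))
  ι-* -[1+ m ] (+ n)    = trans (ι-◃⁻ (suc m ℕ.* n)) (trans (-‿cong (ν-* (suc m) n)) (-‿distribˡ-* _ _))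
  ι-* -[1+ m ] -[1+ n ] = begin
    ι (Sign.+ ◃ (suc m ℕ.* suc n))  ≈⟨ ι-◃⁺ (suc m ℕ.* suc n) ⟩
    ν (suc m ℕ.* suc n)             ≈⟨ ν-* (suc m) (suc n) ⟩
    ν (suc m) * ν (suc n)           ≈⟨ -‿involutive _ ⟨
    - - (ν (suc m) * ν (suc n))     ≈⟨ -‿cong (-‿distribʳ-* _ _) ⟩
    - (ν (suc m) * - ν (suc n))     ≈⟨ -‿distribˡ-* _ _ ⟩
    - ν (suc m) * - ν (suc n)       ∎

  ι-1 : ι 1ℤ ≈ 1#
  ι-1 = +-identityʳ 1#

  ι≉0 : ∀ {i} → i ≢ 0ℤ → ¬ (ι i ≈ 0#)
  ι≉0 {+ zero}    i≢0 _   = i≢0 ≡.refl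
  ι≉0 {+ suc n}   _   ι≈0 = charZero n ι≈0
  ι≉0 { -[1+ n ]} _   ι≈0 = charZero n (trans (sym (-‿involutive _)) (trans (-‿cong ι≈0) -0#≈0#))

  private
    ringᴬ : AlmostCommutativeRing 0ℓ 0ℓ
    ringᴬ = fromCommutativeRing cring

    ι-morphism : ℤ.+-*-rawRing -Raw-AlmostCommutative⟶ ringᴬ
    ι-morphism = record
      { ⟦_⟧ = ι ; +-homo = ι-+ ; *-homo = ι-* ; -‿homo = ι-neg ; 0-homo = refl ; 1-homo = ι-1 }

    _≟ᶜ_ : WeaklyDecidable (Induced-equivalence ι-morphism)
    i ≟ᶜ j with i ℤ.≟ j
    ... | yes ≡.refl = just refl
    ... | no _       = nothing

  open import Algebra.Solver.Ring ℤ.+-*-rawRing ringᴬ ι-morphism _≟ᶜ_ public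
    using (solve; _:=_; _:+_; _:*_; :-_; con)

module FieldProperties (K : CharZeroField) where
  open CharZeroField K
  open import Relation.Binary.Reasoning.Setoid setoid

  x*y≈0⇒y≈0 : ∀ {x y} → ¬ (x ≈ 0#) → x * y ≈ 0# → y ≈ 0#
  x*y≈0⇒y≈0 {x} {y} x≉0 xy≈0 with inverse x x≉0
  ... | x⁻¹ , xx⁻¹≈1 = begin
    y                ≈⟨ *-identityˡ y ⟨
    1# * y           ≈⟨ *-congʳ (trans (sym xx⁻¹≈1) (*-comm x x⁻¹)) ⟩
    (x⁻¹ * x) * y    ≈⟨ *-assoc x⁻¹ x y ⟩
    x⁻¹ * (x * y)    ≈⟨ *-congˡ xy≈0 ⟩
    x⁻¹ * 0#         ≈⟨ zeroʳ x⁻¹ ⟩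
    0#               ∎

  pow≉0 : ∀ {x} → ¬ (x ≈ 0#) → ∀ n → ¬ (pow K x n ≈ 0#)
  pow≉0 x≉0 zero    = nontrivial
  pow≉0 x≉0 (suc n) = pow≉0 x≉0 n ∘ x*y≈0⇒y≈0 x≉0

OneMod : ℕ → ℤ → Set
OneMod p D = ∃ λ k → D ≡ 1ℤ ℤ.+ + p ℤ.* k

OneMod-1 : ∀ p → OneMod p 1ℤ
OneMod-1 p = 0ℤ , ≡.cong (λ j → 1ℤ ℤ.+ j) (≡.sym (ℤ.*-zeroʳ (+ p)))

OneMod-* : ∀ {p D E} → OneMod p D → OneMod p E → OneMod p (D ℤ.* E)
OneMod-* {p} (a , ≡.refl) (b , ≡.refl) = a ℤ.+ b ℤ.+ + p ℤ.* a ℤ.* b , expand (+ p) a b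
  where
  expand : ∀ p a b →
    (1ℤ ℤ.+ p ℤ.* a) ℤ.* (1ℤ ℤ.+ p ℤ.* b) ≡ 1ℤ ℤ.+ p ℤ.* (a ℤ.+ b ℤ.+ p ℤ.* a ℤ.* b)
  expand = ℤ-Solver.solve-∀

OneMod-− : ∀ {p D} c → OneMod p D → OneMod p (D ℤ.- + p ℤ.* c)
OneMod-− {p} c (k , ≡.refl) = k ℤ.- c , regroup (+ p) k c
  where
  regroup : ∀ p k c → 1ℤ ℤ.+ p ℤ.* k ℤ.- p ℤ.* c ≡ 1ℤ ℤ.+ p ℤ.* (k ℤ.- c)
  regroup = ℤ-Solver.solve-∀

OneMod⇒≢0 : ∀ {p D} → p ≢ 1 → OneMod p D → D ≢ 0ℤ
OneMod⇒≢0 {p} p≢1 (k , ≡.refl) 1+pk≡0 = p≢1 (ℕ.m*n≡1⇒m≡1 p ℤ.∣ k ∣ (begin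
  p ℕ.* ℤ.∣ k ∣                       ≡⟨ ℤ.abs-* (+ p) k ⟨
  ℤ.∣ + p ℤ.* k ∣                     ≡⟨ ≡.cong ℤ.∣_∣ (isolate (+ p ℤ.* k)) ⟩
  ℤ.∣ ℤ.-1ℤ ℤ.+ (1ℤ ℤ.+ + p ℤ.* k) ∣   ≡⟨ ≡.cong (λ j → ℤ.∣ ℤ.-1ℤ ℤ.+ j ∣) 1+pk≡0 ⟩
  1                                   ∎))
  where
  open ≡.≡-Reasoning
  isolate : ∀ j → j ≡ ℤ.-1ℤ ℤ.+ (1ℤ ℤ.+ j)
  isolate = ℤ-Solver.solve-∀

module Nakayama (K : CharZeroField) where
  open CharZeroField K
  open IntegerEmbedding K
  open FieldProperties K
  open import Relation.Binary.Reasoning.Setoid setoid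

  Span : List Carrier → Carrier → Set
  Span []       x = x ≈ 0#
  Span (w ∷ ws) x = ∃₂ λ c y → Span ws y × x ≈ ι c * w + y

  Span-resp : ∀ ws {x x′} → x ≈ x′ → Span ws x → Span ws x′
  Span-resp []       x≈x′ x≈0                = trans (sym x≈x′) x≈0
  Span-resp (w ∷ ws) x≈x′ (c , y , y∈ , x≈) = c , y , y∈ , trans (sym x≈x′) x≈

  Span-0 : ∀ ws → Span ws 0#
  Span-0 []       = refl
  Span-0 (w ∷ ws) = 0ℤ , 0# , Span-0 ws , sym (trans (+-congʳ (zeroˡ w)) (+-identityˡ 0#))

  Span-+ : ∀ ws {x x′} → Span ws x → Span ws x′ → Span ws (x + x′)
  Span-+ []       x≈0 x′≈0 = trans (+-cong x≈0 x′≈0) (+-identityʳ 0#)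
  Span-+ (w ∷ ws) {x} {x′} (c , y , y∈ , x≈) (c′ , y′ , y′∈ , x′≈) =
    c ℤ.+ c′ , y + y′ , Span-+ ws y∈ y′∈ , (begin
      x + x′                                ≈⟨ +-cong x≈ x′≈ ⟩
      ι c * w + y + (ι c′ * w + y′)         ≈⟨ solve 5 (λ C W Y C′ Y′ →
                                                   C :* W :+ Y :+ (C′ :* W :+ Y′) := (C :+ C′) :* W :+ (Y :+ Y′))
                                                 refl (ι c) w y (ι c′) y′ ⟩
      (ι c + ι c′) * w + (y + y′)           ≈⟨ +-congʳ (*-congʳ (ι-+ c c′)) ⟨
      ι (c ℤ.+ c′) * w + (y + y′)           ∎)

  Span-⋆ : ∀ ws k {x} → Span ws x → Span ws (ι k * x)
  Span-⋆ []       k     x≈0                = trans (*-congˡ x≈0) (zeroʳ (ι k))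
  Span-⋆ (w ∷ ws) k {x} (c , y , y∈ , x≈) = k ℤ.* c , ι k * y , Span-⋆ ws k y∈ , (begin
    ι k * x                      ≈⟨ *-congˡ x≈ ⟩
    ι k * (ι c * w + y)          ≈⟨ solve 4 (λ Kk C W Y → Kk :* (C :* W :+ Y) := Kk :* C :* W :+ Kk :* Y)
                                      refl (ι k) (ι c) w y ⟩
    ι k * ι c * w + ι k * y      ≈⟨ +-congʳ (*-congʳ (ι-* k c)) ⟨
    ι (k ℤ.* c) * w + ι k * y    ∎)

  Span-∈ : ∀ ws {w} → w ∈ ws → Span ws w
  Span-∈ (w ∷ ws)     (here ≡.refl) =
    1ℤ , 0# , Span-0 ws , sym (trans (+-identityʳ _) (trans (*-congʳ ι-1) (*-identityˡ w)))
  Span-∈ (w ∷ ws) {x} (there x∈)    =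
    0ℤ , x , Span-∈ ws x∈ , sym (trans (+-congʳ (zeroˡ w)) (+-identityˡ x))

  Span-zeros : ∀ ws → All (_≈ 0#) ws → ∀ {y} → Span ws y → y ≈ 0#
  Span-zeros []       []               y≈0                = y≈0
  Span-zeros (w ∷ ws) (w≈0 ∷ ws≈0) {x} (c , y , y∈ , x≈) = begin
    x                 ≈⟨ x≈ ⟩
    ι c * w + y       ≈⟨ +-cong (trans (*-congˡ w≈0) (zeroʳ (ι c))) (Span-zeros ws ws≈0 y∈) ⟩
    0# + 0#           ≈⟨ +-identityʳ 0# ⟩
    0#                ∎

  -- w ∈ p · Span ws over the local ring ℤ₍ₚ₎, with the denominator D cleared.
  PMultiple : ℕ → List Carrier → Carrier → Set
  PMultiple p ws w = ∃ λ D → OneMod p D × ∃ λ y → Span ws y × ι D * w ≈ ι (+ p) * y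

  pivot : ∀ {p ws w} → PMultiple p (w ∷ ws) w → PMultiple p ws w
  pivot {p} {ws} {w} (D , D≡1 , y , (c , y′ , y′∈ , y≈) , Dw≈) =
    D ℤ.- + p ℤ.* c , OneMod-− {p} c D≡1 , y′ , y′∈ , (begin
    ι (D ℤ.- + p ℤ.* c) * w             ≈⟨ *-congʳ ι[D−pc]≈ ⟩
    (ι D + - (ι (+ p) * ι c)) * w       ≈⟨ solve 4 (λ Dd P C W →
                                               (Dd :+ :- (P :* C)) :* W := Dd :* W :+ :- (P :* C :* W))
                                             refl (ι D) (ι (+ p)) (ι c) w ⟩
    ι D * w + - (ι (+ p) * ι c * w)     ≈⟨ +-congʳ (trans Dw≈ (*-congˡ y≈)) ⟩
    ι (+ p) * (ι c * w + y′) + - (ι (+ p) * ι c * w)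
                                        ≈⟨ solve 4 (λ P C W Y → P :* (C :* W :+ Y) :+ :- (P :* C :* W) := P :* Y)
                                             refl (ι (+ p)) (ι c) w y′ ⟩
    ι (+ p) * y′                        ∎)
    where
    ι[D−pc]≈ : ι (D ℤ.- + p ℤ.* c) ≈ ι D + - (ι (+ p) * ι c)
    ι[D−pc]≈ = trans (ι-+ D _) (+-congˡ (trans (ι-neg (+ p ℤ.* c)) (-‿cong (ι-* (+ p) c))))

  eliminate : ∀ {p ws w x} → PMultiple p ws w → PMultiple p (w ∷ ws) x → PMultiple p ws x
  eliminate {p} {ws} {w} {x} (D , D≡1 , y , y∈ , Dw≈) (E , E≡1 , z , (c , z′ , z′∈ , z≈) , Ex≈) =
    D ℤ.* E , OneMod-* {p} D≡1 E≡1 ,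
    ι c * (ι (+ p) * y) + ι D * z′ , Span-+ ws (Span-⋆ ws c (Span-⋆ ws (+ p) y∈)) (Span-⋆ ws D z′∈) , (begin
      ι (D ℤ.* E) * x                               ≈⟨ trans (*-congʳ (ι-* D E)) (*-assoc _ _ _) ⟩
      ι D * (ι E * x)                               ≈⟨ *-congˡ (trans Ex≈ (*-congˡ z≈)) ⟩
      ι D * (ι (+ p) * (ι c * w + z′))              ≈⟨ solve 5 (λ Dd P C W Z →
                                                         Dd :* (P :* (C :* W :+ Z)) := P :* (C :* (Dd :* W) :+ Dd :* Z))
                                                       refl (ι D) (ι (+ p)) (ι c) w z′ ⟩
      ι (+ p) * (ι c * (ι D * w) + ι D * z′)        ≈⟨ *-congˡ (+-congʳ (*-congˡ Dw≈)) ⟩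
      ι (+ p) * (ι c * (ι (+ p) * y) + ι D * z′)    ∎)

  PMultiple-zeros : ∀ {p ws w} → p ≢ 1 → All (_≈ 0#) ws → PMultiple p ws w → w ≈ 0#
  PMultiple-zeros {p} {ws} p≢1 ws≈0 (D , D≡1 , y , y∈ , Dw≈) =
    x*y≈0⇒y≈0 (ι≉0 (OneMod⇒≢0 p≢1 D≡1)) (trans Dw≈ (trans (*-congˡ (Span-zeros ws ws≈0 y∈)) (zeroʳ _)))

  -- Gaussian elimination: each pivot scale stays ≡ 1 (mod p), hence is nonzero in characteristic 0.
  nakayama : ∀ {p} → p ≢ 1 → ∀ ws → All (PMultiple p ws) ws → All (_≈ 0#) ws
  nakayama p≢1 []       []           = []
  nakayama {p} p≢1 (w ∷ ws) (w∈ ∷ ws∈) = PMultiple-zeros p≢1 ws≈0 (pivot {p} {ws} w∈) ∷ ws≈0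
    where
    ws≈0 : All (_≈ 0#) ws
    ws≈0 = nakayama p≢1 ws (All.map (eliminate {p} {ws} (pivot {p} {ws} w∈)) ws∈)

Mono : Set
Mono = ℕ × ℕ × ℕ

degree : Mono → ℕ
degree (a , b , e) = a ℕ.+ b ℕ.+ e

_≟ᴹ_ : DecidableEquality Mono
_≟ᴹ_ = Product.≡-dec ℕ._≟_ (Product.≡-dec ℕ._≟_ ℕ._≟_)

_*ᴹ_ : Mono → Mono → Mono
(a , b , e) *ᴹ (a′ , b′ , e′) = (a ℕ.+ a′ , b ℕ.+ b′ , e ℕ.+ e′)

degree-*ᴹ : ∀ m m′ → degree (m *ᴹ m′) ≡ degree m ℕ.+ degree m′
degree-*ᴹ (a , b , e) (a′ , b′ , e′) = +-interchange a b e a′ b′ e′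
  where
  +-interchange : ∀ a b e a′ b′ e′ →
    a ℕ.+ a′ ℕ.+ (b ℕ.+ b′) ℕ.+ (e ℕ.+ e′) ≡ a ℕ.+ b ℕ.+ e ℕ.+ (a′ ℕ.+ b′ ℕ.+ e′)
  +-interchange = ℕ-Solver.solve-∀

shift : Mono → Poly → Poly
shift m = map (λ (c , m′) → (c , m *ᴹ m′))

⋆-homogeneous : ∀ {d} k {f} → IsHomogeneous d f → IsHomogeneous d (k ⋆ f)
⋆-homogeneous k = All.map⁺

shift-homogeneous : ∀ {d} m {f} → IsHomogeneous d f → IsHomogeneous (degree m ℕ.+ d) (shift m f)
shift-homogeneous m =
  All.map⁺ ∘ All.map (λ {(c , m′)} deg → ≡.trans (degree-*ᴹ m m′) (≡.cong (degree m ℕ.+_) deg))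

homogeneous? : ∀ d → Decidable (IsHomogeneous d)
homogeneous? d = all? (λ (c , m) → degree m ℕ.≟ d)

pairs : ℕ → List (ℕ × ℕ)
pairs zero    = [ (0 , 0) ]
pairs (suc n) = (0 , suc n) ∷ map (λ (b , e) → (suc b , e)) (pairs n)

monomials : ℕ → List Mono
monomials zero    = [ (0 , 0 , 0) ]
monomials (suc n) = map (0 ,_) (pairs (suc n)) ++ map (λ (a , b , e) → (suc a , b , e)) (monomials n)

∈-pairs : ∀ {b e} n → b ℕ.+ e ≡ n → (b , e) ∈ pairs n
∈-pairs {zero}  zero    ≡.refl = here ≡.refl
∈-pairs {zero}  (suc n) b+e≡n  = here (≡.cong (0 ,_) b+e≡n)
∈-pairs {suc b} (suc n) b+e≡n  = there (∈-map⁺ _ (∈-pairs n (ℕ.suc-injective b+e≡n)))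

∈-monomials : ∀ {m} n → degree m ≡ n → m ∈ monomials n
∈-monomials {zero  , zero , zero} zero    ≡.refl = here ≡.refl
∈-monomials {zero  , b , e}       (suc n) deg    = ∈-++⁺ˡ (∈-map⁺ _ (∈-pairs (suc n) deg))
∈-monomials {suc a , b , e}       (suc n) deg    = ∈-++⁺ʳ _ (∈-map⁺ _ (∈-monomials n (ℕ.suc-injective deg)))

insert : Term → Poly → Poly
insert t         []                 = [ t ]
insert t@(c , m) (s@(c′ , m′) ∷ f) =
  if does (m ≟ᴹ m′) then (c ℤ.+ c′ , m) ∷ f else s ∷ insert t f

collect : Poly → Poly
collect = foldr insert []

-- Zero terms are allowed in any degree: differentiation and collect leave zero coefficients
-- on monomials of the wrong degree.
DivisibleTerm : ℕ → ℕ → Term → Set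
DivisibleTerm p d (c , m) = c ≡ 0ℤ ⊎ (degree m ≡ d × + p ∣ c)

Divisible : ℕ → ℕ → Poly → Set
Divisible p d = All (DivisibleTerm p d)

divisible? : ∀ p d → Decidable (Divisible p d)
divisible? p d = all? λ (c , m) → (c ℤ.≟ 0ℤ) ⊎-dec ((degree m ℕ.≟ d) ×-dec (+ p ∣? c))

⋆-divisible : ∀ {p d k f} → + p ∣ k → IsHomogeneous d f → Divisible p d (k ⋆ f)
⋆-divisible p∣k = All.map⁺ ∘ All.map (λ {(c , m)} deg → inj₂ (deg , ∣m⇒∣m*n c p∣k))

⋆-preserves-divisible : ∀ {p d} k {f} → Divisible p d f → Divisible p d (k ⋆ f)
⋆-preserves-divisible k = All.map⁺ ∘ All.map λ where
  (inj₁ ≡.refl)      → inj₁ (ℤ.*-zeroʳ k)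
  (inj₂ (deg , p∣c)) → inj₂ (deg , ∣n⇒∣m*n k p∣c)

∂x-divisible : ∀ {p d f} → Divisible p (suc d) f → Divisible p d (∂x f)
∂x-divisible = All.map⁺ ∘ All.map (λ {(c , a , b , e)} → ∂x-term c a b e)
  where
  ∂x-term : ∀ {p d} c a b e → DivisibleTerm p (suc d) (c , a , b , e) →
            DivisibleTerm p d (c ℤ.* + a , a ℕ.∸ 1 , b , e)
  ∂x-term c a       b e (inj₁ ≡.refl)      = inj₁ ≡.refl
  ∂x-term c zero    b e (inj₂ _)           = inj₁ (ℤ.*-zeroʳ c)
  ∂x-term c (suc a) b e (inj₂ (deg , p∣c)) = inj₂ (ℕ.suc-injective deg , ∣m⇒∣m*n (+ suc a) p∣c)

∂y-divisible : ∀ {p d f} → Divisible p (suc d) f → Divisible p d (∂y f)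
∂y-divisible = All.map⁺ ∘ All.map (λ {(c , a , b , e)} → ∂y-term c a b e)
  where
  ∂y-term : ∀ {p d} c a b e → DivisibleTerm p (suc d) (c , a , b , e) →
            DivisibleTerm p d (c ℤ.* + b , a , b ℕ.∸ 1 , e)
  ∂y-term c a b       e (inj₁ ≡.refl)      = inj₁ ≡.refl
  ∂y-term c a zero    e (inj₂ _)           = inj₁ (ℤ.*-zeroʳ c)
  ∂y-term c a (suc b) e (inj₂ (deg , p∣c)) =
    inj₂ (ℕ.suc-injective (≡.trans (≡.cong (ℕ._+ e) (≡.sym (ℕ.+-suc a b))) deg) , ∣m⇒∣m*n (+ suc b) p∣c)

∂z-divisible : ∀ {p d f} → Divisible p (suc d) f → Divisible p d (∂z f)
∂z-divisible = All.map⁺ ∘ All.map (λ {(c , a , b , e)} → ∂z-term c a b e)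
  where
  ∂z-term : ∀ {p d} c a b e → DivisibleTerm p (suc d) (c , a , b , e) →
            DivisibleTerm p d (c ℤ.* + e , a , b , e ℕ.∸ 1)
  ∂z-term c a b e       (inj₁ ≡.refl)      = inj₁ ≡.refl
  ∂z-term c a b zero    (inj₂ _)           = inj₁ (ℤ.*-zeroʳ c)
  ∂z-term c a b (suc e) (inj₂ (deg , p∣c)) =
    inj₂ (ℕ.suc-injective (≡.trans (≡.sym (ℕ.+-suc (a ℕ.+ b) e)) deg) , ∣m⇒∣m*n (+ suc e) p∣c)

-- A certificate grows a list of entries (d , f), each asserting that at the point in question f
-- is p times the value of an integral form of degree d. A step (d , f , items) appends (d , f)
-- when f − Σ c·xᵐ·fₖ over its items (c , m , k) is divisible by p in degree d, where fₖ is the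
-- k-th entry (counted from 0).
Entry : Set
Entry = ℕ × Poly

Item : Set
Item = ℤ × Mono × ℕ

Step : Set
Step = ℕ × Poly × List Item

_≟ᴱ_ : DecidableEquality Entry
_≟ᴱ_ = Product.≡-dec ℕ._≟_ (List.≡-dec (Product.≡-dec ℤ._≟_ _≟ᴹ_))

entry : List Entry → ℕ → Maybe Entry
entry []       _       = nothing
entry (e ∷ es) zero    = just e
entry (e ∷ es) (suc k) = entry es k

itemPoly : List Entry → Item → Poly
itemPoly es (c , m , k) = maybe (λ (_ , g) → c ⋆ shift m g) [] (entry es k)

itemValid : List Entry → ℕ → Item → Bool
itemValid es d (c , m , k) = maybe (λ (dₖ , _) → ⌊ degree m ℕ.+ dₖ ℕ.≟ d ⌋) false (entry es k)

residual : List Entry → Step → Poly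
residual es (d , f , items) = collect (f ⊕ ℤ.-1ℤ ⋆ concatMap (itemPoly es) items)

stepValid : ℕ → List Entry → Step → Bool
stepValid p es s@(d , f , items) = all (itemValid es d) items ∧ ⌊ divisible? p d (residual es s) ⌋

append : List Entry → Step → List Entry
append es (d , f , _) = es ++ [ (d , f) ]

stepsValid : ℕ → List Entry → List Step → Bool
stepsValid p es []       = true
stepsValid p es (s ∷ ss) = stepValid p es s ∧ stepsValid p (append es s) ss

covers : List Entry → ℕ → Mono → Bool
covers es n m = any (λ e → ⌊ e ≟ᴱ (n , [ (1ℤ , m) ]) ⌋) es

certifies : ℕ → List Entry → List Step → ℕ → Bool
certifies p es ss n = stepsValid p es ss ∧ all (covers (foldl append es ss) n) (monomials n)

module Evaluation (K : CharZeroField) (u v t : CharZeroField.Carrier K) where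
  open CharZeroField K
  open IntegerEmbedding K
  open FieldProperties K
  open Nakayama K
  private
    module +-Comm = Algebra.Properties.CommutativeSemigroup +-commutativeSemigroup
    module *-Comm = Algebra.Properties.CommutativeSemigroup *-commutativeSemigroup
  open import Relation.Binary.Reasoning.Setoid setoid

  monomial : Mono → Carrier
  monomial (a , b , e) = pow K u a * (pow K v b * pow K t e)

  ev : Poly → Carrier
  ev f = eval K f u v t

  ev-++ : ∀ f g → ev (f ++ g) ≈ ev f + ev g
  ev-++ []      g = sym (+-identityˡ _)
  ev-++ (s ∷ f) g = trans (+-congˡ (ev-++ f g)) (sym (+-assoc _ _ _))

  ev-⋆ : ∀ k f → ev (k ⋆ f) ≈ ι k * ev f
  ev-⋆ k []            = sym (zeroʳ (ι k))
  ev-⋆ k ((c , m) ∷ f) = begin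
    ι (k ℤ.* c) * monomial m + ev (k ⋆ f)   ≈⟨ +-cong (trans (*-congʳ (ι-* k c)) (*-assoc _ _ _)) (ev-⋆ k f) ⟩
    ι k * (ι c * monomial m) + ι k * ev f   ≈⟨ distribˡ (ι k) _ _ ⟨
    ι k * (ι c * monomial m + ev f)         ∎

  pow-+ : ∀ x m n → pow K x (m ℕ.+ n) ≈ pow K x m * pow K x n
  pow-+ x zero    n = sym (*-identityˡ _)
  pow-+ x (suc m) n = trans (*-congˡ (pow-+ x m n)) (sym (*-assoc _ _ _))

  monomial-*ᴹ : ∀ m m′ → monomial (m *ᴹ m′) ≈ monomial m * monomial m′
  monomial-*ᴹ (a , b , e) (a′ , b′ , e′) = begin
    pow K u (a ℕ.+ a′) * (pow K v (b ℕ.+ b′) * pow K t (e ℕ.+ e′))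
      ≈⟨ *-cong (pow-+ u a a′) (*-cong (pow-+ v b b′) (pow-+ t e e′)) ⟩
    uᵃ * uᵃ′ * (vᵇ * vᵇ′ * (tᵉ * tᵉ′))
      ≈⟨ solve 6 (λ U U′ V V′ T T′ →
                    U :* U′ :* (V :* V′ :* (T :* T′)) := U :* (V :* T) :* (U′ :* (V′ :* T′)))
           refl uᵃ uᵃ′ vᵇ vᵇ′ tᵉ tᵉ′ ⟩
    uᵃ * (vᵇ * tᵉ) * (uᵃ′ * (vᵇ′ * tᵉ′))  ∎
    where
    uᵃ uᵃ′ vᵇ vᵇ′ tᵉ tᵉ′ : Carrier
    uᵃ = pow K u a
    uᵃ′ = pow K u a′
    vᵇ = pow K v b
    vᵇ′ = pow K v b′
    tᵉ = pow K t e
    tᵉ′ = pow K t e′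

  ev-shift : ∀ m f → ev (shift m f) ≈ monomial m * ev f
  ev-shift m []             = sym (zeroʳ _)
  ev-shift m ((c , m′) ∷ f) = begin
    ι c * monomial (m *ᴹ m′) + ev (shift m f)             ≈⟨ +-cong (*-congˡ (monomial-*ᴹ m m′)) (ev-shift m f) ⟩
    ι c * (monomial m * monomial m′) + monomial m * ev f  ≈⟨ +-congʳ (*-Comm.x∙yz≈y∙xz _ _ _) ⟩
    monomial m * (ι c * monomial m′) + monomial m * ev f  ≈⟨ distribˡ (monomial m) _ _ ⟨
    monomial m * (ι c * monomial m′ + ev f)               ∎

  ev-insert : ∀ s f → ev (insert s f) ≈ ev [ s ] + ev f
  ev-insert s         []                  = sym (+-identityʳ _)
  ev-insert s@(c , m) (s′@(c′ , m′) ∷ f) with m ≟ᴹ m′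
  ... | yes ≡.refl = begin
    ι (c ℤ.+ c′) * monomial m + ev f                      ≈⟨ +-congʳ (trans (*-congʳ (ι-+ c c′)) (distribʳ _ _ _)) ⟩
    ι c * monomial m + ι c′ * monomial m + ev f           ≈⟨ +-assoc _ _ _ ⟩
    ι c * monomial m + (ι c′ * monomial m + ev f)         ≈⟨ +-congʳ (+-identityʳ _) ⟨
    ι c * monomial m + 0# + (ι c′ * monomial m + ev f)    ∎
  ... | no _ = begin
    ι c′ * monomial m′ + ev (insert s f)                  ≈⟨ +-congˡ (ev-insert s f) ⟩
    ι c′ * monomial m′ + (ev [ s ] + ev f)                ≈⟨ +-Comm.x∙yz≈y∙xz _ _ _ ⟩
    ev [ s ] + (ι c′ * monomial m′ + ev f)                ∎

  ev-collect : ∀ f → ev (collect f) ≈ ev f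
  ev-collect []      = refl
  ev-collect (s ∷ f) = trans (ev-insert s (collect f)) (+-cong (+-identityʳ _) (ev-collect f))

  Form : ℕ → Carrier → Set
  Form d x = ∃ λ f → IsHomogeneous d f × ev f ≈ x

  Form-0 : ∀ {d} → Form d 0#
  Form-0 = [] , [] , refl

  Form-term : ∀ c m → Form (degree m) (ι c * monomial m)
  Form-term c m = [ (c , m) ] , ≡.refl ∷ [] , +-identityʳ _

  Form-+ : ∀ {d x y} → Form d x → Form d y → Form d (x + y)
  Form-+ (f , f-hom , f≈) (g , g-hom , g≈) = f ++ g , All.++⁺ f-hom g-hom , trans (ev-++ f g) (+-cong f≈ g≈)

  Form-⋆ : ∀ {d x} k → Form d x → Form d (ι k * x)
  Form-⋆ k (f , f-hom , f≈) = k ⋆ f , ⋆-homogeneous k f-hom , trans (ev-⋆ k f) (*-congˡ f≈)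

  Form-shift : ∀ {d x} m → Form d x → Form (degree m ℕ.+ d) (monomial m * x)
  Form-shift m (f , f-hom , f≈) = shift m f , shift-homogeneous m f-hom , trans (ev-shift m f) (*-congˡ f≈)

  Multiple : ℕ → ℕ → Carrier → Set
  Multiple p d x = ∃ λ y → Form d y × x ≈ ι (+ p) * y

  Multiple-resp : ∀ {p d x x′} → x ≈ x′ → Multiple p d x → Multiple p d x′
  Multiple-resp x≈x′ (y , y-form , x≈) = y , y-form , trans (sym x≈x′) x≈

  Multiple-0 : ∀ {p d} → Multiple p d 0#
  Multiple-0 = 0# , Form-0 , sym (zeroʳ _)

  Multiple-+ : ∀ {p d x x′} → Multiple p d x → Multiple p d x′ → Multiple p d (x + x′)
  Multiple-+ (y , y-form , x≈) (y′ , y′-form , x′≈) =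
    y + y′ , Form-+ y-form y′-form , trans (+-cong x≈ x′≈) (sym (distribˡ _ _ _))

  Multiple-⋆ : ∀ {p d x} k → Multiple p d x → Multiple p d (ι k * x)
  Multiple-⋆ k (y , y-form , x≈) = ι k * y , Form-⋆ k y-form , trans (*-congˡ x≈) (*-Comm.x∙yz≈y∙xz _ _ _)

  Multiple-shift : ∀ {p d x} m → Multiple p d x → Multiple p (degree m ℕ.+ d) (monomial m * x)
  Multiple-shift m (y , y-form , x≈) =
    monomial m * y , Form-shift m y-form , trans (*-congˡ x≈) (*-Comm.x∙yz≈y∙xz _ _ _)

  Divisible⇒Multiple : ∀ {p d} f → Divisible p d f → Multiple p d (ev f)
  Divisible⇒Multiple {p} []            []                   = Multiple-0 {p}
  Divisible⇒Multiple {p} ((c , m) ∷ f) (inj₁ ≡.refl ∷ f-div) =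
    Multiple-resp {p} (sym (trans (+-congʳ (zeroˡ _)) (+-identityˡ _))) (Divisible⇒Multiple f f-div)
  Divisible⇒Multiple {p} ((c , m) ∷ f) (inj₂ (≡.refl , divides q ≡.refl) ∷ f-div) =
    Multiple-+ {p} (ι q * monomial m , Form-term q m , trans (*-congʳ (trans (ι-* q (+ p)) (*-comm _ _))) (*-assoc _ _ _))
               (Divisible⇒Multiple f f-div)

  Form⇒Span : ∀ {n y} → Form n y → Span (map monomial (monomials n)) y
  Form⇒Span {n} (f , f-hom , f≈) = Span-resp ws f≈ (ev∈Span f f-hom)
    where
    ws : List Carrier
    ws = map monomial (monomials n)
    ev∈Span : ∀ f → IsHomogeneous n f → Span ws (ev f)
    ev∈Span []            []            = Span-0 ws
    ev∈Span ((c , m) ∷ f) (deg ∷ f-hom) =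
      Span-+ ws (Span-⋆ ws c (Span-∈ ws (∈-map⁺ monomial (∈-monomials {m} n deg)))) (ev∈Span f f-hom)

  monomials-vanish : ∀ {p} n → p ≢ 1 → (∀ {m} → m ∈ monomials n → Multiple p n (monomial m)) →
                     ∀ {m} → m ∈ monomials n → monomial m ≈ 0#
  monomials-vanish {p} n p≢1 multiple = All.lookup all-vanish ∘ ∈-map⁺ monomial
    where
    ws : List Carrier
    ws = map monomial (monomials n)
    all-vanish : All (_≈ 0#) ws
    all-vanish = nakayama p≢1 ws (All.map⁺ (All.tabulate λ m∈ → unit-scaled (multiple m∈)))
      where
      unit-scaled : ∀ {w} → Multiple p n w → PMultiple p ws w
      unit-scaled (y , y-form , w≈) =
        1ℤ , OneMod-1 p , y , Form⇒Span y-form , trans (trans (*-congʳ ι-1) (*-identityˡ _)) w≈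

  -- Only ¬¬: equality in K is not assumed decidable.
  origin : ∀ n → (∀ {m} → m ∈ monomials n → monomial m ≈ 0#) → ¬ ¬ (u ≈ 0# × v ≈ 0# × t ≈ 0#)
  origin n vanish not-origin =
    ¬¬u≈0 λ u≈0 → ¬¬v≈0 λ v≈0 → ¬¬t≈0 λ t≈0 → not-origin (u≈0 , v≈0 , t≈0)
    where
    vanish-at : ∀ m → degree m ≡ n → monomial m ≈ 0#
    vanish-at m deg = vanish (∈-monomials {m} n deg)
    ¬¬u≈0 : ¬ ¬ (u ≈ 0#)
    ¬¬u≈0 u≉0 = pow≉0 u≉0 n (trans (sym (trans (*-congˡ (*-identityˡ 1#)) (*-identityʳ _)))
                                   (vanish-at (n , 0 , 0) (≡.trans (ℕ.+-identityʳ (n ℕ.+ 0)) (ℕ.+-identityʳ n))))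
    ¬¬v≈0 : ¬ ¬ (v ≈ 0#)
    ¬¬v≈0 v≉0 = pow≉0 v≉0 n (trans (sym (trans (*-identityˡ _) (*-identityʳ _)))
                                   (vanish-at (0 , n , 0) (ℕ.+-identityʳ n)))
    ¬¬t≈0 : ¬ ¬ (t ≈ 0#)
    ¬¬t≈0 t≉0 = pow≉0 t≉0 n (trans (sym (trans (*-identityˡ _) (*-identityˡ _)))
                                   (vanish-at (0 , 0 , n) ≡.refl))

  Multiple-of-vanishing-sum : ∀ {p d} f g → ev (f ++ g) ≈ 0# → Multiple p d (ev g) → Multiple p d (ev f)
  Multiple-of-vanishing-sum {p} f g f+g≈0 g-multiple = Multiple-resp {p} −g≈f (Multiple-⋆ {p} ℤ.-1ℤ g-multiple)
    where
    −g≈f : ι ℤ.-1ℤ * ev g ≈ ev f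
    −g≈f = begin
      ι ℤ.-1ℤ * ev g                     ≈⟨ +-identityʳ _ ⟨
      ι ℤ.-1ℤ * ev g + 0#                ≈⟨ +-congˡ (trans (sym f+g≈0) (ev-++ f g)) ⟩
      ι ℤ.-1ℤ * ev g + (ev f + ev g)     ≈⟨ solve 2 (λ F G → con ℤ.-1ℤ :* G :+ (F :+ G) := F)
                                              refl (ev f) (ev g) ⟩
      ev f                               ∎

module Certified (K : CharZeroField) (u v t : CharZeroField.Carrier K) (p : ℕ) where
  open CharZeroField K
  open IntegerEmbedding K
  open Evaluation K u v t
  open import Relation.Binary.Reasoning.Setoid setoid

  ValidEntry : Entry → Set
  ValidEntry (d , f) = Multiple p d (ev f)

  entry-valid : ∀ es k {e} → All ValidEntry es → entry es k ≡ just e → ValidEntry e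
  entry-valid (e ∷ es) zero    (valid ∷ _)      ≡.refl = valid
  entry-valid (e ∷ es) (suc k) (_ ∷ es-valid) eq     = entry-valid es k es-valid eq

  item-sound : ∀ es d it → All ValidEntry es → T (itemValid es d it) → Multiple p d (ev (itemPoly es it))
  item-sound es d (c , m , k) es-valid ok with entry es k in eq
  ... | just (dₖ , g) =
    Multiple-resp {p} (sym (trans (ev-⋆ c (shift m g)) (*-congˡ (ev-shift m g))))
      (≡.subst (λ d → Multiple p d _) (toWitness {a? = degree m ℕ.+ dₖ ℕ.≟ d} ok)
        (Multiple-⋆ {p} c (Multiple-shift {p} m (entry-valid es k es-valid eq))))

  items-sound : ∀ es d items → All ValidEntry es → T (all (itemValid es d) items) →
                Multiple p d (ev (concatMap (itemPoly es) items))
  items-sound es d []           es-valid _  = Multiple-0 {p}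
  items-sound es d (it ∷ items) es-valid ok with Equivalence.to T-∧ ok
  ... | it-ok , items-ok = Multiple-resp {p} (sym (ev-++ (itemPoly es it) _))
    (Multiple-+ {p} (item-sound es d it es-valid it-ok) (items-sound es d items es-valid items-ok))

  step-sound : ∀ es d f items → All ValidEntry es → T (stepValid p es (d , f , items)) → Multiple p d (ev f)
  step-sound es d f items es-valid ok with Equivalence.to T-∧ ok
  ... | items-ok , residual-ok =
    Multiple-resp {p} cancel (Multiple-+ {p} residual-multiple (items-sound es d items es-valid items-ok))
    where
    C : Poly
    C = concatMap (itemPoly es) items
    residual-multiple : Multiple p d (ev (f ⊕ ℤ.-1ℤ ⋆ C))
    residual-multiple = Multiple-resp {p} (ev-collect (f ⊕ ℤ.-1ℤ ⋆ C))
      (Divisible⇒Multiple (residual es (d , f , items))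
        (toWitness {a? = divisible? p d (residual es (d , f , items))} residual-ok))
    cancel : ev (f ⊕ ℤ.-1ℤ ⋆ C) + ev C ≈ ev f
    cancel = begin
      ev (f ⊕ ℤ.-1ℤ ⋆ C) + ev C       ≈⟨ +-congʳ (trans (ev-++ f _) (+-congˡ (ev-⋆ ℤ.-1ℤ C))) ⟩
      ev f + ι ℤ.-1ℤ * ev C + ev C    ≈⟨ solve 2 (λ F G → F :+ con ℤ.-1ℤ :* G :+ G := F) refl (ev f) (ev C) ⟩
      ev f                            ∎

  steps-sound : ∀ es ss → All ValidEntry es → T (stepsValid p es ss) → All ValidEntry (foldl append es ss)
  steps-sound es []                       es-valid _  = es-valid
  steps-sound es (s@(d , f , items) ∷ ss) es-valid ok with Equivalence.to T-∧ ok
  ... | s-ok , ss-ok =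
    steps-sound (append es s) ss (All.++⁺ es-valid (step-sound es d f items es-valid s-ok ∷ [])) ss-ok

  covers-sound : ∀ es n m → All ValidEntry es → T (covers es n m) → Multiple p n (monomial m)
  covers-sound es n m es-valid ok =
    Multiple-resp {p} (trans (+-identityʳ _) (trans (*-congʳ ι-1) (*-identityˡ _)))
      (All.lookupWith (λ valid is-target → ≡.subst ValidEntry (toWitness {a? = _ ≟ᴱ (n , [ (1ℤ , m) ])} is-target) valid)
        es-valid (Any.any⁻ _ es ok))

  certified⇒origin : p ≢ 1 → ∀ es ss n → All ValidEntry es → T (certifies p es ss n) →
                     ¬ ¬ (u ≈ 0# × v ≈ 0# × t ≈ 0#)
  certified⇒origin p≢1 es ss n es-valid ok with Equivalence.to T-∧ ok
  ... | ss-ok , covered = origin n (monomials-vanish n p≢1 λ {m} m∈ →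
    covers-sound (foldl append es ss) n m (steps-sound es ss es-valid ss-ok) (All.lookup (All.all⁺ _ _ covered) m∈))

certified⇒smooth : ∀ p d n (g r : Poly) ss → p ≢ 1 →
  Divisible p d (∂x r) → Divisible p d (∂y r) → Divisible p d (∂z r) →
  T (certifies p ((d , ∂x g) ∷ (d , ∂y g) ∷ (d , ∂z g) ∷ []) ss n) →
  SmoothPlaneCurve (g ⊕ r)
certified⇒smooth p d n g r ss p≢1 ∂xr ∂yr ∂zr certified K u v t not-origin (_ , ∂xf≈0 , ∂yf≈0 , ∂zf≈0) =
  certified⇒origin p≢1 _ ss n (start ∂xr ∂xf≈0 ∷ start ∂yr ∂yf≈0 ∷ start ∂zr ∂zf≈0 ∷ [])
    certified not-origin
  where
  open CharZeroField K using (_≈_; 0#; trans; reflexive)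
  open Evaluation K u v t
  open Certified K u v t p
  start : ∀ {δ} → Divisible p d (map δ r) → ev (map δ (g ⊕ r)) ≈ 0# → Multiple p d (ev (map δ g))
  start {δ} δr δf≈0 = Multiple-of-vanishing-sum {p} (map δ g) (map δ r)
    (trans (reflexive (≡.cong ev (≡.sym (List.map-++ δ g r)))) δf≈0) (Divisible⇒Multiple (map δ r) δr)

F₀′ : Poly
F₀′ = + 73 ⋆ (+ 7 ⋆ F₀)

F₀-homogeneous : IsHomogeneous 6 F₀
F₀-homogeneous = toWitness {a? = homogeneous? 6 F₀} tt

-- Linear algebra over 𝔽₅ in degrees 5 to 13; the final steps produce the degree-13 monomials.
F₀-certificate : List Step
F₀-certificate =
    (5  , (+ 3 , 0 , 0 , 5) ∷ (+ 4 , 0 , 5 , 0) ∷ (+ 3 , 1 , 4 , 0) ∷ (+ 3 , 2 , 0 , 3) ∷ (+ 4 , 2 , 3 , 0) ∷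
          (+ 2 , 3 , 0 , 2) ∷ (+ 1 , 3 , 2 , 0) ∷ []
        , (+ 4 , (0 , 0 , 0) , 0) ∷ [])
  ∷ (5  , (+ 4 , 0 , 5 , 0) ∷ (+ 4 , 2 , 3 , 0) ∷ (+ 1 , 3 , 2 , 0) ∷ (+ 2 , 4 , 1 , 0) ∷ (+ 1 , 5 , 0 , 0) ∷ []
        , (+ 1 , (0 , 0 , 0) , 1) ∷ [])
  ∷ (5  , (+ 4 , 0 , 0 , 5) ∷ (+ 2 , 0 , 5 , 0) ∷ (+ 2 , 2 , 3 , 0) ∷ (+ 2 , 3 , 0 , 2) ∷ (+ 3 , 3 , 2 , 0) ∷
          (+ 4 , 4 , 0 , 1) ∷ (+ 1 , 4 , 1 , 0) ∷ []
        , (+ 1 , (0 , 0 , 0) , 2) ∷ (+ 3 , (0 , 0 , 0) , 4) ∷ [])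
  ∷ (6  , (+ 4 , 0 , 1 , 5) ∷ (+ 2 , 0 , 6 , 0) ∷ (+ 4 , 1 , 0 , 5) ∷ (+ 3 , 1 , 5 , 0) ∷ (+ 1 , 2 , 1 , 3) ∷
          (+ 1 , 2 , 4 , 0) ∷ (+ 4 , 3 , 0 , 3) ∷ (+ 3 , 3 , 1 , 2) ∷ (+ 1 , 4 , 0 , 2) ∷ (+ 3 , 4 , 1 , 1) ∷ []
        , (+ 3 , (1 , 0 , 0) , 3) ∷ (+ 2 , (0 , 1 , 0) , 5) ∷ (+ 2 , (0 , 1 , 0) , 3) ∷ [])
  ∷ (6  , (+ 2 , 0 , 1 , 5) ∷ (+ 4 , 0 , 6 , 0) ∷ (+ 3 , 1 , 0 , 5) ∷ (+ 1 , 1 , 5 , 0) ∷ (+ 2 , 2 , 1 , 3) ∷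
          (+ 1 , 3 , 0 , 3) ∷ (+ 3 , 3 , 1 , 2) ∷ (+ 2 , 5 , 0 , 1) ∷ []
        , (+ 2 , (0 , 1 , 0) , 4) ∷ (+ 3 , (1 , 0 , 0) , 5) ∷ (+ 2 , (1 , 0 , 0) , 3) ∷ (+ 4 , (0 , 1 , 0) , 3) ∷ [])
  ∷ (7  , (+ 4 , 0 , 1 , 6) ∷ (+ 1 , 0 , 2 , 5) ∷ (+ 1 , 0 , 6 , 1) ∷ (+ 2 , 1 , 0 , 6) ∷ (+ 1 , 1 , 1 , 5) ∷
          (+ 2 , 2 , 0 , 5) ∷ (+ 4 , 2 , 1 , 4) ∷ (+ 2 , 2 , 2 , 3) ∷ (+ 4 , 3 , 0 , 4) ∷ (+ 2 , 4 , 0 , 3) ∷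
          (+ 2 , 4 , 1 , 2) ∷ (+ 1 , 5 , 0 , 2) ∷ []
        , (+ 4 , (2 , 0 , 0) , 3) ∷ (+ 1 , (0 , 2 , 0) , 4) ∷ (+ 2 , (1 , 1 , 0) , 3) ∷ (+ 4 , (0 , 2 , 0) , 3) ∷
          (+ 3 , (0 , 1 , 0) , 6) ∷ (+ 1 , (0 , 1 , 0) , 7) ∷ (+ 3 , (0 , 1 , 1) , 4) ∷ (+ 2 , (0 , 1 , 1) , 3) ∷
          (+ 4 , (0 , 0 , 1) , 7) ∷ [])
  ∷ (7  , (+ 1 , 0 , 2 , 5) ∷ (+ 1 , 0 , 7 , 0) ∷ (+ 2 , 2 , 0 , 5) ∷ (+ 3 , 2 , 2 , 3) ∷ (+ 3 , 3 , 1 , 3) ∷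
          (+ 1 , 3 , 2 , 2) ∷ (+ 4 , 4 , 0 , 3) ∷ (+ 3 , 4 , 1 , 2) ∷ (+ 3 , 4 , 2 , 1) ∷ (+ 2 , 5 , 1 , 1) ∷
          (+ 3 , 6 , 0 , 1) ∷ []
        , (+ 1 , (0 , 1 , 0) , 6) ∷ (+ 4 , (1 , 0 , 0) , 7) ∷ (+ 1 , (0 , 1 , 0) , 7) ∷ [])
  ∷ (8  , (+ 4 , 0 , 0 , 8) ∷ (+ 3 , 0 , 2 , 6) ∷ (+ 2 , 0 , 3 , 5) ∷ (+ 1 , 0 , 5 , 3) ∷ (+ 3 , 1 , 0 , 7) ∷
          (+ 3 , 1 , 1 , 6) ∷ (+ 3 , 1 , 2 , 5) ∷ (+ 2 , 1 , 4 , 3) ∷ (+ 4 , 2 , 1 , 5) ∷ (+ 3 , 2 , 2 , 4) ∷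
          (+ 1 , 2 , 3 , 3) ∷ (+ 1 , 3 , 0 , 5) ∷ (+ 4 , 3 , 1 , 4) ∷ (+ 4 , 4 , 0 , 4) ∷ []
        , (+ 1 , (0 , 3 , 0) , 3) ∷ (+ 4 , (2 , 0 , 0) , 7) ∷ (+ 2 , (0 , 2 , 0) , 7) ∷ (+ 3 , (0 , 1 , 0) , 9) ∷
          (+ 2 , (2 , 0 , 1) , 4) ∷ (+ 2 , (1 , 1 , 1) , 4) ∷ (+ 4 , (2 , 0 , 1) , 3) ∷ (+ 1 , (0 , 1 , 1) , 6) ∷
          (+ 4 , (0 , 1 , 1) , 7) ∷ (+ 2 , (0 , 1 , 0) , 8) ∷ (+ 3 , (0 , 1 , 2) , 4) ∷ (+ 3 , (1 , 0 , 2) , 3) ∷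
          (+ 4 , (0 , 1 , 2) , 3) ∷ (+ 3 , (0 , 0 , 2) , 6) ∷ (+ 2 , (0 , 0 , 2) , 7) ∷ (+ 3 , (0 , 0 , 1) , 8) ∷
          (+ 1 , (0 , 0 , 3) , 4) ∷ (+ 3 , (0 , 0 , 3) , 5) ∷ (+ 4 , (0 , 0 , 3) , 3) ∷ [])
  ∷ (8  , (+ 2 , 0 , 1 , 7) ∷ (+ 3 , 0 , 3 , 5) ∷ (+ 3 , 1 , 1 , 6) ∷ (+ 4 , 1 , 2 , 5) ∷ (+ 1 , 1 , 4 , 3) ∷
          (+ 1 , 2 , 0 , 6) ∷ (+ 3 , 2 , 1 , 5) ∷ (+ 3 , 3 , 0 , 5) ∷ (+ 3 , 3 , 1 , 4) ∷ (+ 4 , 4 , 0 , 4) ∷ []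
        , (+ 4 , (0 , 3 , 0) , 5) ∷ (+ 1 , (2 , 0 , 0) , 6) ∷ (+ 2 , (0 , 1 , 0) , 9) ∷ (+ 1 , (1 , 1 , 1) , 4) ∷
          (+ 4 , (2 , 0 , 1) , 3) ∷ (+ 1 , (1 , 1 , 1) , 3) ∷ (+ 1 , (0 , 1 , 1) , 6) ∷ (+ 4 , (0 , 1 , 1) , 7) ∷
          (+ 2 , (0 , 1 , 0) , 8) ∷ (+ 4 , (1 , 0 , 2) , 4) ∷ (+ 4 , (0 , 1 , 2) , 4) ∷ (+ 4 , (0 , 0 , 2) , 6) ∷
          (+ 2 , (0 , 0 , 2) , 7) ∷ (+ 3 , (0 , 0 , 1) , 8) ∷ (+ 1 , (0 , 0 , 3) , 4) ∷ (+ 4 , (0 , 0 , 3) , 5) ∷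
          (+ 1 , (0 , 0 , 3) , 3) ∷ (+ 4 , (0 , 0 , 0) , 10) ∷ [])
  ∷ (8  , (+ 1 , 0 , 0 , 8) ∷ (+ 3 , 0 , 2 , 6) ∷ (+ 1 , 0 , 5 , 3) ∷ (+ 1 , 1 , 0 , 7) ∷ (+ 3 , 1 , 1 , 6) ∷
          (+ 2 , 1 , 2 , 5) ∷ (+ 1 , 2 , 0 , 6) ∷ (+ 3 , 2 , 1 , 5) ∷ (+ 2 , 2 , 2 , 4) ∷ (+ 2 , 3 , 0 , 5) ∷
          (+ 4 , 3 , 1 , 4) ∷ (+ 1 , 4 , 0 , 4) ∷ []
        , (+ 2 , (0 , 1 , 1) , 7) ∷ (+ 3 , (1 , 0 , 0) , 8) ∷ (+ 2 , (0 , 1 , 0) , 8) ∷ (+ 2 , (1 , 0 , 2) , 4) ∷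
          (+ 4 , (0 , 1 , 2) , 4) ∷ (+ 1 , (1 , 0 , 2) , 3) ∷ (+ 4 , (0 , 1 , 2) , 3) ∷ (+ 1 , (0 , 0 , 2) , 7) ∷
          (+ 4 , (0 , 0 , 1) , 8) ∷ (+ 3 , (0 , 0 , 3) , 4) ∷ (+ 2 , (0 , 0 , 3) , 5) ∷ (+ 4 , (0 , 0 , 3) , 3) ∷
          (+ 4 , (0 , 0 , 0) , 10) ∷ [])
  ∷ (9  , (+ 3 , 0 , 2 , 7) ∷ (+ 2 , 1 , 0 , 8) ∷ (+ 2 , 1 , 1 , 7) ∷ (+ 3 , 1 , 2 , 6) ∷ (+ 3 , 1 , 3 , 5) ∷
          (+ 4 , 2 , 0 , 7) ∷ (+ 3 , 2 , 1 , 6) ∷ (+ 4 , 2 , 2 , 5) ∷ (+ 4 , 3 , 0 , 6) ∷ (+ 1 , 4 , 0 , 5) ∷ []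
        , (+ 1 , (0 , 1 , 3) , 3) ∷ (+ 4 , (1 , 0 , 0) , 10) ∷ (+ 3 , (0 , 0 , 3) , 6) ∷ (+ 4 , (0 , 0 , 3) , 7) ∷
          (+ 4 , (0 , 0 , 2) , 8) ∷ (+ 2 , (0 , 0 , 4) , 4) ∷ (+ 3 , (0 , 0 , 4) , 5) ∷ (+ 2 , (0 , 0 , 4) , 3) ∷
          (+ 3 , (0 , 0 , 1) , 10) ∷ (+ 3 , (0 , 0 , 1) , 11) ∷ [])
  ∷ (9  , (+ 1 , 0 , 0 , 9) ∷ (+ 3 , 0 , 1 , 8) ∷ (+ 3 , 0 , 2 , 7) ∷ (+ 2 , 0 , 3 , 6) ∷ (+ 3 , 1 , 0 , 8) ∷
          (+ 1 , 1 , 1 , 7) ∷ (+ 3 , 1 , 2 , 6) ∷ (+ 1 , 1 , 3 , 5) ∷ (+ 3 , 2 , 1 , 6) ∷ (+ 4 , 2 , 2 , 5) ∷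
          (+ 3 , 3 , 0 , 6) ∷ (+ 1 , 3 , 1 , 5) ∷ []
        , (+ 4 , (0 , 4 , 0) , 4) ∷ (+ 1 , (3 , 0 , 0) , 6) ∷ (+ 4 , (1 , 3 , 0) , 3) ∷ (+ 3 , (0 , 4 , 0) , 3) ∷
          (+ 2 , (0 , 2 , 0) , 9) ∷ (+ 2 , (2 , 1 , 1) , 4) ∷ (+ 4 , (2 , 1 , 1) , 3) ∷ (+ 3 , (0 , 3 , 1) , 3) ∷
          (+ 4 , (0 , 2 , 1) , 6) ∷ (+ 4 , (0 , 2 , 1) , 7) ∷ (+ 4 , (0 , 2 , 0) , 8) ∷ (+ 4 , (2 , 0 , 2) , 4) ∷
          (+ 4 , (1 , 1 , 2) , 4) ∷ (+ 1 , (2 , 0 , 2) , 3) ∷ (+ 2 , (1 , 1 , 2) , 3) ∷ (+ 4 , (0 , 1 , 2) , 6) ∷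
          (+ 4 , (0 , 1 , 2) , 7) ∷ (+ 1 , (0 , 1 , 1) , 8) ∷ (+ 1 , (1 , 0 , 3) , 4) ∷ (+ 3 , (0 , 1 , 3) , 3) ∷
          (+ 2 , (0 , 0 , 3) , 7) ∷ (+ 4 , (0 , 0 , 4) , 4) ∷ (+ 1 , (0 , 0 , 4) , 3) ∷ (+ 1 , (0 , 0 , 1) , 10) ∷
          (+ 4 , (0 , 0 , 1) , 12) ∷ [])
  ∷ (9  , (+ 4 , 0 , 0 , 9) ∷ (+ 2 , 0 , 1 , 8) ∷ (+ 2 , 0 , 2 , 7) ∷ (+ 3 , 0 , 3 , 6) ∷ (+ 1 , 0 , 4 , 5) ∷
          (+ 3 , 1 , 0 , 8) ∷ (+ 4 , 1 , 1 , 7) ∷ (+ 2 , 1 , 2 , 6) ∷ (+ 4 , 1 , 3 , 5) ∷ (+ 1 , 2 , 0 , 7) ∷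
          (+ 2 , 2 , 1 , 6) ∷ (+ 1 , 2 , 2 , 5) ∷ (+ 1 , 3 , 0 , 6) ∷ []
        , (+ 1 , (0 , 4 , 0) , 5) ∷ (+ 4 , (3 , 0 , 0) , 7) ∷ (+ 1 , (0 , 4 , 0) , 3) ∷ (+ 4 , (0 , 3 , 0) , 6) ∷
          (+ 1 , (0 , 2 , 0) , 9) ∷ (+ 2 , (3 , 0 , 1) , 4) ∷ (+ 1 , (2 , 1 , 1) , 4) ∷ (+ 3 , (3 , 0 , 1) , 3) ∷
          (+ 2 , (2 , 1 , 1) , 3) ∷ (+ 4 , (0 , 3 , 1) , 3) ∷ (+ 2 , (0 , 2 , 1) , 6) ∷ (+ 2 , (0 , 2 , 1) , 7) ∷
          (+ 2 , (0 , 2 , 0) , 8) ∷ (+ 3 , (1 , 1 , 2) , 4) ∷ (+ 3 , (2 , 0 , 2) , 3) ∷ (+ 3 , (1 , 1 , 2) , 3) ∷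
          (+ 4 , (0 , 1 , 2) , 6) ∷ (+ 4 , (0 , 1 , 2) , 7) ∷ (+ 1 , (0 , 1 , 1) , 8) ∷ (+ 4 , (0 , 1 , 3) , 4) ∷
          (+ 3 , (1 , 0 , 3) , 3) ∷ (+ 1 , (0 , 0 , 3) , 6) ∷ (+ 2 , (0 , 0 , 2) , 8) ∷ (+ 3 , (0 , 0 , 4) , 4) ∷
          (+ 4 , (0 , 0 , 4) , 5) ∷ (+ 3 , (0 , 0 , 4) , 3) ∷ (+ 1 , (0 , 0 , 1) , 11) ∷ (+ 3 , (0 , 0 , 1) , 12) ∷
          (+ 1 , (0 , 0 , 0) , 14) ∷ [])
  ∷ (9  , (+ 2 , 0 , 0 , 9) ∷ (+ 4 , 0 , 2 , 7) ∷ (+ 4 , 0 , 3 , 6) ∷ (+ 3 , 1 , 0 , 8) ∷ (+ 3 , 1 , 1 , 7) ∷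
          (+ 4 , 1 , 2 , 6) ∷ (+ 1 , 1 , 3 , 5) ∷ (+ 4 , 2 , 0 , 7) ∷ []
        , (+ 1 , (0 , 2 , 1) , 6) ∷ (+ 4 , (2 , 0 , 0) , 8) ∷ (+ 2 , (0 , 2 , 1) , 7) ∷ (+ 1 , (2 , 0 , 2) , 4) ∷
          (+ 3 , (1 , 1 , 2) , 3) ∷ (+ 3 , (0 , 2 , 2) , 3) ∷ (+ 4 , (0 , 1 , 2) , 7) ∷ (+ 2 , (0 , 1 , 1) , 8) ∷
          (+ 2 , (1 , 0 , 3) , 4) ∷ (+ 1 , (0 , 1 , 3) , 4) ∷ (+ 3 , (1 , 0 , 3) , 3) ∷ (+ 2 , (0 , 0 , 3) , 6) ∷
          (+ 4 , (0 , 0 , 3) , 7) ∷ (+ 1 , (0 , 0 , 2) , 8) ∷ (+ 1 , (0 , 0 , 4) , 5) ∷ (+ 3 , (0 , 0 , 4) , 3) ∷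
          (+ 2 , (0 , 0 , 1) , 10) ∷ (+ 2 , (0 , 0 , 1) , 11) ∷ (+ 4 , (0 , 0 , 1) , 12) ∷ (+ 3 , (0 , 0 , 0) , 13) ∷
          (+ 2 , (0 , 0 , 0) , 14) ∷ [])
  ∷ (9  , (+ 3 , 0 , 0 , 9) ∷ (+ 4 , 0 , 1 , 8) ∷ (+ 1 , 0 , 2 , 7) ∷ (+ 2 , 0 , 3 , 6) ∷ (+ 1 , 0 , 4 , 5) ∷
          (+ 2 , 1 , 0 , 8) ∷ (+ 3 , 1 , 1 , 7) ∷ (+ 2 , 1 , 2 , 6) ∷ (+ 4 , 2 , 0 , 7) ∷ (+ 1 , 2 , 1 , 6) ∷ []
        , (+ 4 , (0 , 3 , 0) , 6) ∷ (+ 1 , (2 , 0 , 0) , 9) ∷ (+ 3 , (0 , 3 , 0) , 7) ∷ (+ 2 , (3 , 0 , 1) , 4) ∷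
          (+ 4 , (2 , 1 , 1) , 4) ∷ (+ 2 , (3 , 0 , 1) , 3) ∷ (+ 4 , (2 , 1 , 1) , 3) ∷ (+ 2 , (0 , 3 , 1) , 3) ∷
          (+ 4 , (0 , 2 , 1) , 7) ∷ (+ 1 , (0 , 2 , 0) , 8) ∷ (+ 2 , (1 , 1 , 2) , 4) ∷ (+ 1 , (2 , 0 , 2) , 3) ∷
          (+ 3 , (1 , 1 , 2) , 3) ∷ (+ 1 , (0 , 2 , 2) , 3) ∷ (+ 3 , (0 , 1 , 2) , 6) ∷ (+ 3 , (0 , 1 , 2) , 7) ∷
          (+ 3 , (0 , 1 , 1) , 8) ∷ (+ 2 , (1 , 0 , 3) , 4) ∷ (+ 1 , (0 , 1 , 3) , 4) ∷ (+ 1 , (1 , 0 , 3) , 3) ∷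
          (+ 2 , (0 , 1 , 3) , 3) ∷ (+ 3 , (0 , 0 , 3) , 6) ∷ (+ 3 , (0 , 0 , 3) , 7) ∷ (+ 1 , (0 , 0 , 4) , 4) ∷
          (+ 2 , (0 , 0 , 4) , 5) ∷ (+ 3 , (0 , 0 , 1) , 10) ∷ (+ 4 , (0 , 0 , 1) , 11) ∷ (+ 4 , (0 , 0 , 1) , 12) ∷
          (+ 2 , (0 , 0 , 0) , 14) ∷ (+ 3 , (0 , 0 , 0) , 15) ∷ [])
  ∷ (10 , (+ 4 , 0 , 0 , 10) ∷ (+ 4 , 0 , 2 , 8) ∷ (+ 2 , 0 , 3 , 7) ∷ (+ 4 , 1 , 0 , 9) ∷ (+ 2 , 2 , 0 , 8) ∷
          (+ 1 , 2 , 1 , 7) ∷ (+ 1 , 3 , 0 , 7) ∷ []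
        , (+ 4 , (0 , 4 , 1) , 3) ∷ (+ 1 , (3 , 0 , 0) , 8) ∷ (+ 4 , (0 , 3 , 1) , 6) ∷ (+ 1 , (0 , 3 , 1) , 7) ∷
          (+ 2 , (0 , 3 , 0) , 8) ∷ (+ 4 , (3 , 0 , 2) , 4) ∷ (+ 1 , (3 , 0 , 2) , 3) ∷ (+ 1 , (2 , 1 , 2) , 3) ∷
          (+ 2 , (1 , 2 , 2) , 3) ∷ (+ 4 , (0 , 3 , 2) , 3) ∷ (+ 4 , (0 , 2 , 2) , 6) ∷ (+ 3 , (0 , 2 , 2) , 7) ∷
          (+ 4 , (0 , 2 , 1) , 8) ∷ (+ 3 , (2 , 0 , 3) , 4) ∷ (+ 4 , (1 , 1 , 3) , 4) ∷ (+ 2 , (2 , 0 , 3) , 3) ∷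
          (+ 3 , (1 , 1 , 3) , 3) ∷ (+ 3 , (0 , 2 , 3) , 3) ∷ (+ 3 , (0 , 1 , 3) , 7) ∷ (+ 1 , (0 , 1 , 2) , 8) ∷
          (+ 4 , (1 , 0 , 4) , 4) ∷ (+ 4 , (0 , 1 , 4) , 4) ∷ (+ 1 , (0 , 1 , 4) , 3) ∷ (+ 1 , (0 , 0 , 4) , 6) ∷
          (+ 3 , (0 , 0 , 4) , 7) ∷ (+ 1 , (0 , 0 , 3) , 8) ∷ (+ 4 , (0 , 0 , 5) , 4) ∷ (+ 4 , (0 , 0 , 5) , 3) ∷
          (+ 4 , (0 , 0 , 2) , 10) ∷ (+ 3 , (0 , 0 , 2) , 11) ∷ (+ 2 , (0 , 0 , 2) , 12) ∷ (+ 4 , (0 , 0 , 1) , 13) ∷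
          (+ 3 , (0 , 0 , 1) , 14) ∷ (+ 2 , (0 , 0 , 1) , 15) ∷ (+ 1 , (0 , 0 , 1) , 17) ∷ [])
  ∷ (10 , (+ 3 , 0 , 0 , 10) ∷ (+ 2 , 0 , 1 , 9) ∷ (+ 4 , 1 , 0 , 9) ∷ (+ 1 , 1 , 1 , 8) ∷ (+ 1 , 2 , 0 , 8) ∷
          (+ 1 , 2 , 1 , 7) ∷ []
        , (+ 4 , (0 , 5 , 0) , 3) ∷ (+ 1 , (3 , 0 , 0) , 9) ∷ (+ 4 , (0 , 4 , 0) , 6) ∷ (+ 1 , (0 , 4 , 0) , 7) ∷
          (+ 2 , (0 , 3 , 0) , 9) ∷ (+ 2 , (4 , 0 , 1) , 4) ∷ (+ 4 , (3 , 1 , 1) , 4) ∷ (+ 2 , (4 , 0 , 1) , 3) ∷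
          (+ 4 , (3 , 1 , 1) , 3) ∷ (+ 1 , (2 , 2 , 1) , 3) ∷ (+ 1 , (0 , 3 , 1) , 6) ∷ (+ 2 , (0 , 3 , 1) , 7) ∷
          (+ 2 , (2 , 1 , 2) , 4) ∷ (+ 4 , (2 , 1 , 2) , 3) ∷ (+ 3 , (1 , 2 , 2) , 3) ∷ (+ 1 , (0 , 3 , 2) , 3) ∷
          (+ 3 , (0 , 2 , 2) , 6) ∷ (+ 1 , (0 , 2 , 2) , 7) ∷ (+ 1 , (0 , 2 , 1) , 8) ∷ (+ 2 , (2 , 0 , 3) , 4) ∷
          (+ 2 , (1 , 1 , 3) , 3) ∷ (+ 2 , (0 , 1 , 3) , 6) ∷ (+ 1 , (0 , 1 , 3) , 7) ∷ (+ 2 , (0 , 1 , 2) , 8) ∷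
          (+ 4 , (1 , 0 , 4) , 4) ∷ (+ 3 , (0 , 1 , 4) , 4) ∷ (+ 1 , (1 , 0 , 4) , 3) ∷ (+ 2 , (0 , 1 , 4) , 3) ∷
          (+ 4 , (0 , 0 , 4) , 7) ∷ (+ 4 , (0 , 0 , 3) , 8) ∷ (+ 1 , (0 , 0 , 5) , 4) ∷ (+ 3 , (0 , 0 , 5) , 5) ∷
          (+ 4 , (0 , 0 , 5) , 3) ∷ (+ 4 , (0 , 0 , 2) , 10) ∷ (+ 1 , (0 , 0 , 2) , 11) ∷ (+ 3 , (0 , 0 , 2) , 12) ∷
          (+ 4 , (0 , 0 , 1) , 13) ∷ (+ 3 , (0 , 0 , 1) , 14) ∷ (+ 4 , (0 , 0 , 1) , 15) ∷ (+ 3 , (0 , 0 , 1) , 16) ∷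
          (+ 2 , (0 , 0 , 1) , 17) ∷ (+ 1 , (0 , 0 , 0) , 18) ∷ [])
  ∷ (10 , (+ 2 , 0 , 0 , 10) ∷ (+ 3 , 0 , 1 , 9) ∷ (+ 3 , 0 , 2 , 8) ∷ (+ 4 , 0 , 3 , 7) ∷ (+ 1 , 1 , 0 , 9) ∷
          (+ 2 , 1 , 1 , 8) ∷ (+ 1 , 1 , 2 , 7) ∷ (+ 4 , 2 , 0 , 8) ∷ []
        , (+ 1 , (0 , 2 , 3) , 3) ∷ (+ 4 , (2 , 0 , 0) , 11) ∷ (+ 1 , (0 , 1 , 3) , 6) ∷ (+ 4 , (0 , 1 , 3) , 7) ∷
          (+ 3 , (0 , 1 , 2) , 8) ∷ (+ 4 , (1 , 0 , 4) , 4) ∷ (+ 4 , (0 , 1 , 4) , 4) ∷ (+ 4 , (1 , 0 , 4) , 3) ∷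
          (+ 4 , (0 , 1 , 4) , 3) ∷ (+ 1 , (0 , 0 , 4) , 6) ∷ (+ 3 , (0 , 0 , 4) , 7) ∷ (+ 4 , (0 , 0 , 3) , 8) ∷
          (+ 3 , (0 , 0 , 5) , 4) ∷ (+ 4 , (0 , 0 , 5) , 5) ∷ (+ 2 , (0 , 0 , 5) , 3) ∷ (+ 4 , (0 , 0 , 2) , 10) ∷
          (+ 1 , (0 , 0 , 2) , 11) ∷ (+ 3 , (0 , 0 , 2) , 12) ∷ (+ 2 , (0 , 0 , 1) , 14) ∷ (+ 2 , (0 , 0 , 1) , 15) ∷
          (+ 3 , (0 , 0 , 1) , 17) ∷ (+ 2 , (0 , 0 , 0) , 18) ∷ (+ 3 , (0 , 0 , 0) , 19) ∷ [])
  ∷ (10 , (+ 3 , 0 , 0 , 10) ∷ (+ 2 , 0 , 2 , 8) ∷ (+ 1 , 0 , 3 , 7) ∷ (+ 4 , 1 , 0 , 9) ∷ (+ 4 , 1 , 1 , 8) ∷ []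
        , (+ 2 , (0 , 0 , 5) , 3) ∷ (+ 3 , (0 , 1 , 0) , 14) ∷ (+ 1 , (0 , 0 , 2) , 11) ∷ (+ 2 , (0 , 0 , 2) , 12) ∷
          (+ 4 , (0 , 0 , 1) , 13) ∷ (+ 1 , (0 , 0 , 1) , 15) ∷ (+ 3 , (0 , 0 , 1) , 17) ∷ (+ 2 , (0 , 0 , 0) , 18) ∷
          (+ 2 , (0 , 0 , 0) , 19) ∷ (+ 4 , (0 , 0 , 0) , 20) ∷ [])
  ∷ (11 , (+ 1 , 0 , 0 , 11) ∷ (+ 1 , 2 , 0 , 9) ∷ []
        , (+ 1 , (0 , 3 , 3) , 3) ∷ (+ 4 , (3 , 0 , 0) , 12) ∷ (+ 1 , (0 , 2 , 3) , 6) ∷ (+ 4 , (0 , 2 , 3) , 7) ∷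
          (+ 3 , (0 , 2 , 2) , 8) ∷ (+ 1 , (2 , 0 , 4) , 4) ∷ (+ 2 , (1 , 1 , 4) , 4) ∷ (+ 1 , (2 , 0 , 4) , 3) ∷
          (+ 1 , (1 , 1 , 4) , 3) ∷ (+ 4 , (0 , 1 , 4) , 6) ∷ (+ 1 , (0 , 1 , 4) , 7) ∷ (+ 3 , (0 , 1 , 3) , 8) ∷
          (+ 2 , (1 , 0 , 5) , 4) ∷ (+ 4 , (0 , 1 , 5) , 4) ∷ (+ 2 , (1 , 0 , 5) , 3) ∷ (+ 3 , (0 , 1 , 5) , 3) ∷
          (+ 2 , (0 , 0 , 4) , 8) ∷ (+ 2 , (0 , 0 , 6) , 4) ∷ (+ 3 , (0 , 0 , 6) , 5) ∷ (+ 2 , (0 , 0 , 6) , 3) ∷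
          (+ 3 , (0 , 0 , 3) , 10) ∷ (+ 3 , (0 , 0 , 3) , 11) ∷ (+ 4 , (0 , 0 , 2) , 13) ∷ (+ 1 , (0 , 0 , 2) , 14) ∷
          (+ 3 , (0 , 0 , 2) , 15) ∷ (+ 2 , (0 , 0 , 2) , 16) ∷ (+ 4 , (0 , 0 , 2) , 17) ∷ (+ 3 , (0 , 0 , 1) , 18) ∷
          (+ 3 , (0 , 0 , 1) , 19) ∷ (+ 2 , (0 , 0 , 1) , 20) ∷ (+ 4 , (0 , 0 , 1) , 21) ∷ [])
  ∷ (11 , (+ 3 , 0 , 1 , 10) ∷ (+ 3 , 0 , 2 , 9) ∷ (+ 2 , 1 , 0 , 10) ∷ (+ 1 , 1 , 1 , 9) ∷ []
        , (+ 4 , (1 , 0 , 5) , 3) ∷ (+ 1 , (0 , 2 , 0) , 13) ∷ (+ 4 , (0 , 1 , 5) , 3) ∷ (+ 3 , (0 , 0 , 5) , 6) ∷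
          (+ 3 , (0 , 0 , 4) , 8) ∷ (+ 2 , (0 , 0 , 6) , 4) ∷ (+ 1 , (0 , 0 , 6) , 5) ∷ (+ 1 , (0 , 0 , 6) , 3) ∷
          (+ 3 , (0 , 0 , 3) , 10) ∷ (+ 3 , (0 , 0 , 3) , 11) ∷ (+ 3 , (0 , 0 , 3) , 12) ∷ (+ 2 , (0 , 0 , 2) , 13) ∷
          (+ 2 , (0 , 0 , 2) , 15) ∷ (+ 4 , (0 , 0 , 2) , 16) ∷ (+ 2 , (0 , 0 , 1) , 18) ∷ (+ 1 , (0 , 0 , 1) , 19) ∷
          (+ 4 , (0 , 0 , 1) , 21) ∷ (+ 4 , (0 , 0 , 0) , 22) ∷ [])
  ∷ (11 , (+ 4 , 0 , 0 , 11) ∷ (+ 1 , 0 , 2 , 9) ∷ (+ 3 , 1 , 0 , 10) ∷ []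
        , (+ 1 , (0 , 1 , 5) , 3) ∷ (+ 4 , (2 , 0 , 0) , 16) ∷ (+ 1 , (0 , 0 , 5) , 6) ∷ (+ 4 , (0 , 0 , 5) , 7) ∷
          (+ 3 , (0 , 0 , 4) , 8) ∷ (+ 4 , (0 , 0 , 6) , 4) ∷ (+ 3 , (0 , 0 , 6) , 5) ∷ (+ 1 , (0 , 0 , 6) , 3) ∷
          (+ 3 , (0 , 0 , 3) , 10) ∷ (+ 1 , (0 , 0 , 3) , 11) ∷ (+ 1 , (0 , 0 , 3) , 12) ∷ (+ 3 , (0 , 0 , 2) , 13) ∷
          (+ 2 , (0 , 0 , 2) , 14) ∷ (+ 2 , (0 , 0 , 2) , 15) ∷ (+ 1 , (0 , 0 , 2) , 16) ∷ (+ 3 , (0 , 0 , 2) , 17) ∷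
          (+ 2 , (0 , 0 , 1) , 18) ∷ (+ 4 , (0 , 0 , 1) , 19) ∷ (+ 1 , (0 , 0 , 1) , 20) ∷ (+ 3 , (0 , 0 , 1) , 21) ∷
          (+ 4 , (0 , 0 , 0) , 22) ∷ (+ 1 , (0 , 0 , 0) , 23) ∷ [])
  ∷ (12 , (+ 2 , 0 , 1 , 11) ∷ (+ 1 , 1 , 0 , 11) ∷ []
        , (+ 1 , (0 , 2 , 5) , 3) ∷ (+ 4 , (3 , 0 , 0) , 17) ∷ (+ 1 , (0 , 1 , 5) , 6) ∷ (+ 4 , (0 , 1 , 5) , 7) ∷
          (+ 3 , (0 , 1 , 4) , 8) ∷ (+ 3 , (1 , 0 , 6) , 3) ∷ (+ 1 , (0 , 0 , 6) , 6) ∷ (+ 3 , (0 , 0 , 5) , 8) ∷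
          (+ 1 , (0 , 0 , 7) , 4) ∷ (+ 3 , (0 , 0 , 7) , 3) ∷ (+ 3 , (0 , 0 , 4) , 10) ∷ (+ 1 , (0 , 0 , 4) , 12) ∷
          (+ 1 , (0 , 0 , 3) , 13) ∷ (+ 2 , (0 , 0 , 3) , 16) ∷ (+ 3 , (0 , 0 , 2) , 18) ∷ (+ 2 , (0 , 0 , 2) , 21) ∷
          (+ 1 , (0 , 0 , 1) , 22) ∷ (+ 2 , (0 , 0 , 1) , 23) ∷ [])
  ∷ (12 , (+ 4 , 0 , 0 , 12) ∷ (+ 1 , 0 , 1 , 11) ∷ []
        , (+ 2 , (0 , 0 , 7) , 3) ∷ (+ 3 , (0 , 2 , 0) , 18) ∷ (+ 4 , (0 , 0 , 4) , 10) ∷ (+ 1 , (0 , 0 , 4) , 11) ∷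
          (+ 2 , (0 , 0 , 4) , 12) ∷ (+ 3 , (0 , 0 , 3) , 13) ∷ (+ 3 , (0 , 0 , 3) , 14) ∷ (+ 4 , (0 , 0 , 3) , 15) ∷
          (+ 2 , (0 , 0 , 3) , 16) ∷ (+ 4 , (0 , 0 , 3) , 17) ∷ (+ 1 , (0 , 0 , 2) , 20) ∷ (+ 1 , (0 , 0 , 2) , 21) ∷
          (+ 2 , (0 , 0 , 1) , 22) ∷ (+ 2 , (0 , 0 , 1) , 24) ∷ (+ 4 , (0 , 0 , 0) , 25) ∷ [])
  ∷ (13 , (+ 1 , 0 , 0 , 13) ∷ []
        , (+ 1 , (0 , 1 , 7) , 3) ∷ (+ 4 , (3 , 0 , 0) , 21) ∷ (+ 1 , (0 , 0 , 7) , 6) ∷ (+ 4 , (0 , 0 , 7) , 7) ∷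
          (+ 3 , (0 , 0 , 6) , 8) ∷ (+ 4 , (0 , 0 , 8) , 4) ∷ (+ 2 , (0 , 0 , 8) , 5) ∷ (+ 2 , (0 , 0 , 8) , 3) ∷
          (+ 2 , (0 , 0 , 5) , 10) ∷ (+ 1 , (0 , 0 , 4) , 13) ∷ (+ 4 , (0 , 0 , 4) , 15) ∷ (+ 1 , (0 , 0 , 4) , 16) ∷
          (+ 1 , (0 , 0 , 4) , 17) ∷ (+ 1 , (0 , 0 , 3) , 19) ∷ (+ 2 , (0 , 0 , 3) , 20) ∷ (+ 3 , (0 , 0 , 2) , 22) ∷
          (+ 2 , (0 , 0 , 2) , 23) ∷ (+ 3 , (0 , 0 , 2) , 24) ∷ (+ 4 , (0 , 0 , 1) , 25) ∷ (+ 4 , (0 , 0 , 1) , 26) ∷ [])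
  ∷ (13 , (+ 1 , 0 , 0 , 13) ∷ []
        , (+ 1 , (0 , 0 , 0) , 27) ∷ [])
  ∷ (13 , (+ 1 , 0 , 1 , 12) ∷ []
        , (+ 1 , (0 , 0 , 1) , 26) ∷ (+ 1 , (0 , 0 , 0) , 28) ∷ [])
  ∷ (13 , (+ 1 , 1 , 0 , 12) ∷ []
        , (+ 1 , (0 , 0 , 1) , 25) ∷ (+ 3 , (0 , 0 , 0) , 29) ∷ [])
  ∷ (13 , (+ 1 , 0 , 2 , 11) ∷ []
        , (+ 1 , (0 , 1 , 0) , 26) ∷ (+ 1 , (0 , 0 , 0) , 29) ∷ [])
  ∷ (13 , (+ 1 , 1 , 1 , 11) ∷ []
        , (+ 1 , (0 , 1 , 0) , 25) ∷ (+ 3 , (0 , 0 , 0) , 31) ∷ [])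
  ∷ (13 , (+ 1 , 2 , 0 , 11) ∷ []
        , (+ 1 , (0 , 0 , 2) , 22) ∷ (+ 4 , (0 , 0 , 0) , 28) ∷ [])
  ∷ (13 , (+ 1 , 0 , 3 , 10) ∷ []
        , (+ 1 , (0 , 1 , 1) , 24) ∷ (+ 2 , (0 , 0 , 0) , 32) ∷ (+ 1 , (0 , 0 , 0) , 29) ∷ [])
  ∷ (13 , (+ 1 , 1 , 2 , 10) ∷ []
        , (+ 1 , (1 , 0 , 1) , 24) ∷ (+ 2 , (0 , 0 , 0) , 33) ∷ (+ 1 , (0 , 0 , 0) , 30) ∷ [])
  ∷ (13 , (+ 1 , 2 , 1 , 10) ∷ []
        , (+ 1 , (0 , 1 , 1) , 22) ∷ (+ 4 , (0 , 0 , 0) , 29) ∷ [])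
  ∷ (13 , (+ 1 , 3 , 0 , 10) ∷ []
        , (+ 1 , (1 , 0 , 1) , 22) ∷ (+ 4 , (0 , 0 , 0) , 30) ∷ [])
  ∷ (13 , (+ 1 , 0 , 4 , 9) ∷ []
        , (+ 1 , (0 , 2 , 0) , 24) ∷ (+ 2 , (0 , 0 , 0) , 35) ∷ (+ 1 , (0 , 0 , 0) , 31) ∷ [])
  ∷ (13 , (+ 1 , 1 , 3 , 9) ∷ []
        , (+ 1 , (1 , 1 , 0) , 24) ∷ (+ 2 , (0 , 0 , 0) , 36) ∷ (+ 1 , (0 , 0 , 0) , 32) ∷ [])
  ∷ (13 , (+ 1 , 2 , 2 , 9) ∷ []
        , (+ 1 , (0 , 2 , 0) , 22) ∷ (+ 4 , (0 , 0 , 0) , 31) ∷ [])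
  ∷ (13 , (+ 1 , 3 , 1 , 9) ∷ []
        , (+ 1 , (1 , 1 , 0) , 22) ∷ (+ 4 , (0 , 0 , 0) , 32) ∷ [])
  ∷ (13 , (+ 1 , 4 , 0 , 9) ∷ []
        , (+ 1 , (2 , 0 , 0) , 22) ∷ (+ 4 , (0 , 0 , 0) , 33) ∷ [])
  ∷ (13 , (+ 1 , 0 , 5 , 8) ∷ []
        , (+ 1 , (0 , 2 , 1) , 21) ∷ (+ 1 , (0 , 0 , 0) , 39) ∷ (+ 1 , (0 , 0 , 0) , 35) ∷ (+ 3 , (0 , 0 , 0) , 38) ∷
          (+ 2 , (0 , 0 , 0) , 31) ∷ [])
  ∷ (13 , (+ 1 , 1 , 4 , 8) ∷ []
        , (+ 1 , (1 , 1 , 1) , 21) ∷ (+ 1 , (0 , 0 , 0) , 40) ∷ (+ 1 , (0 , 0 , 0) , 36) ∷ (+ 3 , (0 , 0 , 0) , 39) ∷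
          (+ 2 , (0 , 0 , 0) , 32) ∷ [])
  ∷ (13 , (+ 1 , 2 , 3 , 8) ∷ []
        , (+ 1 , (2 , 0 , 1) , 21) ∷ (+ 1 , (0 , 0 , 0) , 41) ∷ (+ 1 , (0 , 0 , 0) , 37) ∷ (+ 3 , (0 , 0 , 0) , 40) ∷
          (+ 2 , (0 , 0 , 0) , 33) ∷ [])
  ∷ (13 , (+ 1 , 3 , 2 , 8) ∷ []
        , (+ 1 , (1 , 1 , 1) , 19) ∷ (+ 3 , (0 , 0 , 0) , 35) ∷ (+ 2 , (0 , 0 , 0) , 32) ∷ (+ 4 , (0 , 0 , 0) , 41) ∷
          (+ 4 , (0 , 0 , 0) , 40) ∷ (+ 1 , (0 , 0 , 0) , 36) ∷ [])
  ∷ (13 , (+ 1 , 4 , 1 , 8) ∷ []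
        , (+ 1 , (2 , 0 , 1) , 19) ∷ (+ 3 , (0 , 0 , 0) , 36) ∷ (+ 2 , (0 , 0 , 0) , 33) ∷ (+ 4 , (0 , 0 , 0) , 42) ∷
          (+ 4 , (0 , 0 , 0) , 41) ∷ (+ 1 , (0 , 0 , 0) , 37) ∷ [])
  ∷ (13 , (+ 1 , 5 , 0 , 8) ∷ []
        , (+ 1 , (0 , 0 , 8) , 4) ∷ (+ 3 , (0 , 0 , 0) , 47) ∷ (+ 4 , (0 , 0 , 0) , 46) ∷ (+ 1 , (0 , 0 , 0) , 45) ∷
          (+ 1 , (0 , 0 , 0) , 43) ∷ [])
  ∷ (13 , (+ 1 , 0 , 6 , 7) ∷ []
        , (+ 1 , (0 , 3 , 0) , 21) ∷ (+ 1 , (0 , 0 , 0) , 44) ∷ (+ 1 , (0 , 0 , 0) , 39) ∷ (+ 3 , (0 , 0 , 0) , 43) ∷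
          (+ 2 , (0 , 0 , 0) , 34) ∷ [])
  ∷ (13 , (+ 1 , 1 , 5 , 7) ∷ []
        , (+ 1 , (1 , 2 , 0) , 21) ∷ (+ 1 , (0 , 0 , 0) , 45) ∷ (+ 1 , (0 , 0 , 0) , 40) ∷ (+ 3 , (0 , 0 , 0) , 44) ∷
          (+ 2 , (0 , 0 , 0) , 35) ∷ [])
  ∷ (13 , (+ 1 , 2 , 4 , 7) ∷ []
        , (+ 1 , (2 , 1 , 0) , 21) ∷ (+ 1 , (0 , 0 , 0) , 46) ∷ (+ 1 , (0 , 0 , 0) , 41) ∷ (+ 3 , (0 , 0 , 0) , 45) ∷
          (+ 2 , (0 , 0 , 0) , 36) ∷ [])
  ∷ (13 , (+ 1 , 3 , 3 , 7) ∷ []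
        , (+ 1 , (3 , 0 , 0) , 21) ∷ (+ 1 , (0 , 0 , 0) , 47) ∷ (+ 1 , (0 , 0 , 0) , 42) ∷ (+ 3 , (0 , 0 , 0) , 46) ∷
          (+ 2 , (0 , 0 , 0) , 37) ∷ [])
  ∷ (13 , (+ 1 , 4 , 2 , 7) ∷ []
        , (+ 1 , (2 , 1 , 0) , 19) ∷ (+ 3 , (0 , 0 , 0) , 40) ∷ (+ 2 , (0 , 0 , 0) , 36) ∷ (+ 4 , (0 , 0 , 0) , 47) ∷
          (+ 4 , (0 , 0 , 0) , 46) ∷ (+ 1 , (0 , 0 , 0) , 41) ∷ [])
  ∷ (13 , (+ 1 , 5 , 1 , 7) ∷ []
        , (+ 1 , (0 , 1 , 7) , 4) ∷ (+ 3 , (0 , 0 , 0) , 53) ∷ (+ 4 , (0 , 0 , 0) , 52) ∷ (+ 1 , (0 , 0 , 0) , 51) ∷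
          (+ 1 , (0 , 0 , 0) , 49) ∷ [])
  ∷ (13 , (+ 1 , 6 , 0 , 7) ∷ []
        , (+ 1 , (1 , 0 , 7) , 4) ∷ (+ 3 , (0 , 0 , 0) , 54) ∷ (+ 4 , (0 , 0 , 0) , 53) ∷ (+ 1 , (0 , 0 , 0) , 52) ∷
          (+ 1 , (0 , 0 , 0) , 50) ∷ [])
  ∷ (13 , (+ 1 , 0 , 7 , 6) ∷ []
        , (+ 1 , (0 , 3 , 1) , 17) ∷ (+ 3 , (0 , 0 , 0) , 49) ∷ (+ 1 , (0 , 0 , 0) , 45) ∷ (+ 1 , (0 , 0 , 0) , 38) ∷
          (+ 3 , (0 , 0 , 0) , 39) ∷ (+ 2 , (0 , 0 , 0) , 44) ∷ (+ 2 , (0 , 0 , 0) , 34) ∷ (+ 3 , (0 , 0 , 0) , 50) ∷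
          (+ 4 , (0 , 0 , 0) , 43) ∷ (+ 4 , (0 , 0 , 0) , 51) ∷ [])
  ∷ (13 , (+ 1 , 1 , 6 , 6) ∷ []
        , (+ 1 , (0 , 1 , 6) , 7) ∷ (+ 1 , (0 , 0 , 0) , 56) ∷ (+ 3 , (0 , 0 , 0) , 54) ∷ (+ 2 , (0 , 0 , 0) , 32) ∷
          (+ 4 , (0 , 0 , 0) , 41) ∷ (+ 2 , (0 , 0 , 0) , 46) ∷ (+ 3 , (0 , 0 , 0) , 40) ∷ (+ 3 , (0 , 0 , 0) , 31) ∷ [])
  ∷ (13 , (+ 1 , 2 , 5 , 6) ∷ []
        , (+ 1 , (1 , 0 , 6) , 7) ∷ (+ 1 , (0 , 0 , 0) , 57) ∷ (+ 3 , (0 , 0 , 0) , 55) ∷ (+ 2 , (0 , 0 , 0) , 33) ∷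
          (+ 4 , (0 , 0 , 0) , 42) ∷ (+ 2 , (0 , 0 , 0) , 47) ∷ (+ 3 , (0 , 0 , 0) , 41) ∷ (+ 3 , (0 , 0 , 0) , 32) ∷ [])
  ∷ (13 , (+ 1 , 3 , 4 , 6) ∷ []
        , (+ 1 , (0 , 2 , 6) , 3) ∷ (+ 3 , (0 , 0 , 0) , 46) ∷ (+ 1 , (0 , 0 , 0) , 58) ∷ (+ 2 , (0 , 0 , 0) , 40) ∷
          (+ 2 , (0 , 0 , 0) , 57) ∷ (+ 1 , (0 , 0 , 0) , 56) ∷ (+ 2 , (0 , 0 , 0) , 31) ∷ [])
  ∷ (13 , (+ 1 , 4 , 3 , 6) ∷ []
        , (+ 1 , (1 , 1 , 6) , 3) ∷ (+ 3 , (0 , 0 , 0) , 47) ∷ (+ 1 , (0 , 0 , 0) , 59) ∷ (+ 2 , (0 , 0 , 0) , 41) ∷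
          (+ 2 , (0 , 0 , 0) , 58) ∷ (+ 1 , (0 , 0 , 0) , 57) ∷ (+ 2 , (0 , 0 , 0) , 32) ∷ [])
  ∷ (13 , (+ 1 , 5 , 2 , 6) ∷ []
        , (+ 1 , (0 , 2 , 6) , 4) ∷ (+ 3 , (0 , 0 , 0) , 60) ∷ (+ 4 , (0 , 0 , 0) , 59) ∷ (+ 1 , (0 , 0 , 0) , 58) ∷
          (+ 1 , (0 , 0 , 0) , 56) ∷ [])
  ∷ (13 , (+ 1 , 6 , 1 , 6) ∷ []
        , (+ 1 , (1 , 1 , 6) , 4) ∷ (+ 3 , (0 , 0 , 0) , 61) ∷ (+ 4 , (0 , 0 , 0) , 60) ∷ (+ 1 , (0 , 0 , 0) , 59) ∷
          (+ 1 , (0 , 0 , 0) , 57) ∷ [])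
  ∷ (13 , (+ 1 , 7 , 0 , 6) ∷ []
        , (+ 1 , (2 , 0 , 6) , 4) ∷ (+ 3 , (0 , 0 , 0) , 62) ∷ (+ 4 , (0 , 0 , 0) , 61) ∷ (+ 1 , (0 , 0 , 0) , 60) ∷
          (+ 1 , (0 , 0 , 0) , 58) ∷ [])
  ∷ (13 , (+ 1 , 0 , 8 , 5) ∷ []
        , (+ 1 , (0 , 4 , 0) , 17) ∷ (+ 3 , (0 , 0 , 0) , 56) ∷ (+ 1 , (0 , 0 , 0) , 51) ∷ (+ 1 , (0 , 0 , 0) , 43) ∷
          (+ 3 , (0 , 0 , 0) , 44) ∷ (+ 2 , (0 , 0 , 0) , 50) ∷ (+ 2 , (0 , 0 , 0) , 38) ∷ (+ 3 , (0 , 0 , 0) , 57) ∷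
          (+ 4 , (0 , 0 , 0) , 49) ∷ (+ 4 , (0 , 0 , 0) , 58) ∷ [])
  ∷ (13 , (+ 1 , 1 , 7 , 5) ∷ []
        , (+ 1 , (0 , 2 , 5) , 7) ∷ (+ 1 , (0 , 0 , 0) , 64) ∷ (+ 3 , (0 , 0 , 0) , 61) ∷ (+ 2 , (0 , 0 , 0) , 35) ∷
          (+ 4 , (0 , 0 , 0) , 46) ∷ (+ 2 , (0 , 0 , 0) , 52) ∷ (+ 3 , (0 , 0 , 0) , 45) ∷ (+ 3 , (0 , 0 , 0) , 34) ∷ [])
  ∷ (13 , (+ 1 , 2 , 6 , 5) ∷ []
        , (+ 1 , (1 , 1 , 5) , 7) ∷ (+ 1 , (0 , 0 , 0) , 65) ∷ (+ 3 , (0 , 0 , 0) , 62) ∷ (+ 2 , (0 , 0 , 0) , 36) ∷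
          (+ 4 , (0 , 0 , 0) , 47) ∷ (+ 2 , (0 , 0 , 0) , 53) ∷ (+ 3 , (0 , 0 , 0) , 46) ∷ (+ 3 , (0 , 0 , 0) , 35) ∷ [])
  ∷ (13 , (+ 1 , 3 , 5 , 5) ∷ []
        , (+ 1 , (0 , 3 , 5) , 3) ∷ (+ 3 , (0 , 0 , 0) , 52) ∷ (+ 1 , (0 , 0 , 0) , 66) ∷ (+ 2 , (0 , 0 , 0) , 45) ∷
          (+ 2 , (0 , 0 , 0) , 65) ∷ (+ 1 , (0 , 0 , 0) , 64) ∷ (+ 2 , (0 , 0 , 0) , 34) ∷ [])
  ∷ (13 , (+ 1 , 4 , 4 , 5) ∷ []
        , (+ 1 , (1 , 2 , 5) , 3) ∷ (+ 3 , (0 , 0 , 0) , 53) ∷ (+ 1 , (0 , 0 , 0) , 67) ∷ (+ 2 , (0 , 0 , 0) , 46) ∷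
          (+ 2 , (0 , 0 , 0) , 66) ∷ (+ 1 , (0 , 0 , 0) , 65) ∷ (+ 2 , (0 , 0 , 0) , 35) ∷ [])
  ∷ (13 , (+ 1 , 5 , 3 , 5) ∷ []
        , (+ 1 , (0 , 3 , 5) , 4) ∷ (+ 3 , (0 , 0 , 0) , 68) ∷ (+ 4 , (0 , 0 , 0) , 67) ∷ (+ 1 , (0 , 0 , 0) , 66) ∷
          (+ 1 , (0 , 0 , 0) , 64) ∷ [])
  ∷ (13 , (+ 1 , 6 , 2 , 5) ∷ []
        , (+ 1 , (1 , 2 , 5) , 4) ∷ (+ 3 , (0 , 0 , 0) , 69) ∷ (+ 4 , (0 , 0 , 0) , 68) ∷ (+ 1 , (0 , 0 , 0) , 67) ∷
          (+ 1 , (0 , 0 , 0) , 65) ∷ [])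
  ∷ (13 , (+ 1 , 7 , 1 , 5) ∷ []
        , (+ 1 , (2 , 1 , 5) , 4) ∷ (+ 3 , (0 , 0 , 0) , 70) ∷ (+ 4 , (0 , 0 , 0) , 69) ∷ (+ 1 , (0 , 0 , 0) , 68) ∷
          (+ 1 , (0 , 0 , 0) , 66) ∷ [])
  ∷ (13 , (+ 1 , 8 , 0 , 5) ∷ []
        , (+ 1 , (3 , 0 , 5) , 4) ∷ (+ 3 , (0 , 0 , 0) , 71) ∷ (+ 4 , (0 , 0 , 0) , 70) ∷ (+ 1 , (0 , 0 , 0) , 69) ∷
          (+ 1 , (0 , 0 , 0) , 67) ∷ [])
  ∷ (13 , (+ 1 , 0 , 9 , 4) ∷ []
        , (+ 1 , (0 , 2 , 4) , 9) ∷ (+ 2 , (0 , 0 , 0) , 60) ∷ (+ 2 , (0 , 0 , 0) , 52) ∷ (+ 2 , (0 , 0 , 0) , 68) ∷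
          (+ 4 , (0 , 0 , 0) , 59) ∷ (+ 4 , (0 , 0 , 0) , 38) ∷ (+ 2 , (0 , 0 , 0) , 51) ∷ (+ 2 , (0 , 0 , 0) , 70) ∷
          (+ 3 , (0 , 0 , 0) , 40) ∷ (+ 1 , (0 , 0 , 0) , 53) ∷ (+ 3 , (0 , 0 , 0) , 69) ∷ [])
  ∷ (13 , (+ 1 , 1 , 8 , 4) ∷ []
        , (+ 1 , (0 , 3 , 4) , 7) ∷ (+ 1 , (0 , 0 , 0) , 73) ∷ (+ 3 , (0 , 0 , 0) , 69) ∷ (+ 2 , (0 , 0 , 0) , 39) ∷
          (+ 4 , (0 , 0 , 0) , 52) ∷ (+ 2 , (0 , 0 , 0) , 59) ∷ (+ 3 , (0 , 0 , 0) , 51) ∷ (+ 3 , (0 , 0 , 0) , 38) ∷ [])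
  ∷ (13 , (+ 1 , 2 , 7 , 4) ∷ []
        , (+ 1 , (1 , 2 , 4) , 7) ∷ (+ 1 , (0 , 0 , 0) , 74) ∷ (+ 3 , (0 , 0 , 0) , 70) ∷ (+ 2 , (0 , 0 , 0) , 40) ∷
          (+ 4 , (0 , 0 , 0) , 53) ∷ (+ 2 , (0 , 0 , 0) , 60) ∷ (+ 3 , (0 , 0 , 0) , 52) ∷ (+ 3 , (0 , 0 , 0) , 39) ∷ [])
  ∷ (13 , (+ 1 , 3 , 6 , 4) ∷ []
        , (+ 1 , (0 , 4 , 4) , 3) ∷ (+ 3 , (0 , 0 , 0) , 59) ∷ (+ 1 , (0 , 0 , 0) , 75) ∷ (+ 2 , (0 , 0 , 0) , 51) ∷
          (+ 2 , (0 , 0 , 0) , 74) ∷ (+ 1 , (0 , 0 , 0) , 73) ∷ (+ 2 , (0 , 0 , 0) , 38) ∷ [])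
  ∷ (13 , (+ 1 , 4 , 5 , 4) ∷ []
        , (+ 1 , (1 , 3 , 4) , 3) ∷ (+ 3 , (0 , 0 , 0) , 60) ∷ (+ 1 , (0 , 0 , 0) , 76) ∷ (+ 2 , (0 , 0 , 0) , 52) ∷
          (+ 2 , (0 , 0 , 0) , 75) ∷ (+ 1 , (0 , 0 , 0) , 74) ∷ (+ 2 , (0 , 0 , 0) , 39) ∷ [])
  ∷ (13 , (+ 1 , 5 , 4 , 4) ∷ []
        , (+ 1 , (0 , 4 , 4) , 4) ∷ (+ 3 , (0 , 0 , 0) , 77) ∷ (+ 4 , (0 , 0 , 0) , 76) ∷ (+ 1 , (0 , 0 , 0) , 75) ∷
          (+ 1 , (0 , 0 , 0) , 73) ∷ [])
  ∷ (13 , (+ 1 , 6 , 3 , 4) ∷ []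
        , (+ 1 , (1 , 3 , 4) , 4) ∷ (+ 3 , (0 , 0 , 0) , 78) ∷ (+ 4 , (0 , 0 , 0) , 77) ∷ (+ 1 , (0 , 0 , 0) , 76) ∷
          (+ 1 , (0 , 0 , 0) , 74) ∷ [])
  ∷ (13 , (+ 1 , 7 , 2 , 4) ∷ []
        , (+ 1 , (2 , 2 , 4) , 4) ∷ (+ 3 , (0 , 0 , 0) , 79) ∷ (+ 4 , (0 , 0 , 0) , 78) ∷ (+ 1 , (0 , 0 , 0) , 77) ∷
          (+ 1 , (0 , 0 , 0) , 75) ∷ [])
  ∷ (13 , (+ 1 , 8 , 1 , 4) ∷ []
        , (+ 1 , (3 , 1 , 4) , 4) ∷ (+ 3 , (0 , 0 , 0) , 80) ∷ (+ 4 , (0 , 0 , 0) , 79) ∷ (+ 1 , (0 , 0 , 0) , 78) ∷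
          (+ 1 , (0 , 0 , 0) , 76) ∷ [])
  ∷ (13 , (+ 1 , 9 , 0 , 4) ∷ []
        , (+ 1 , (4 , 0 , 4) , 4) ∷ (+ 3 , (0 , 0 , 0) , 81) ∷ (+ 4 , (0 , 0 , 0) , 80) ∷ (+ 1 , (0 , 0 , 0) , 79) ∷
          (+ 1 , (0 , 0 , 0) , 77) ∷ [])
  ∷ (13 , (+ 1 , 0 , 10 , 3) ∷ []
        , (+ 1 , (0 , 3 , 3) , 9) ∷ (+ 2 , (0 , 0 , 0) , 68) ∷ (+ 2 , (0 , 0 , 0) , 59) ∷ (+ 2 , (0 , 0 , 0) , 77) ∷
          (+ 4 , (0 , 0 , 0) , 67) ∷ (+ 4 , (0 , 0 , 0) , 43) ∷ (+ 2 , (0 , 0 , 0) , 58) ∷ (+ 2 , (0 , 0 , 0) , 79) ∷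
          (+ 3 , (0 , 0 , 0) , 45) ∷ (+ 1 , (0 , 0 , 0) , 60) ∷ (+ 3 , (0 , 0 , 0) , 78) ∷ [])
  ∷ (13 , (+ 1 , 1 , 9 , 3) ∷ []
        , (+ 1 , (0 , 4 , 3) , 7) ∷ (+ 1 , (0 , 0 , 0) , 83) ∷ (+ 3 , (0 , 0 , 0) , 78) ∷ (+ 2 , (0 , 0 , 0) , 44) ∷
          (+ 4 , (0 , 0 , 0) , 59) ∷ (+ 2 , (0 , 0 , 0) , 67) ∷ (+ 3 , (0 , 0 , 0) , 58) ∷ (+ 3 , (0 , 0 , 0) , 43) ∷ [])
  ∷ (13 , (+ 1 , 2 , 8 , 3) ∷ []
        , (+ 1 , (1 , 3 , 3) , 7) ∷ (+ 1 , (0 , 0 , 0) , 84) ∷ (+ 3 , (0 , 0 , 0) , 79) ∷ (+ 2 , (0 , 0 , 0) , 45) ∷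
          (+ 4 , (0 , 0 , 0) , 60) ∷ (+ 2 , (0 , 0 , 0) , 68) ∷ (+ 3 , (0 , 0 , 0) , 59) ∷ (+ 3 , (0 , 0 , 0) , 44) ∷ [])
  ∷ (13 , (+ 1 , 3 , 7 , 3) ∷ []
        , (+ 1 , (0 , 5 , 3) , 3) ∷ (+ 3 , (0 , 0 , 0) , 67) ∷ (+ 1 , (0 , 0 , 0) , 85) ∷ (+ 2 , (0 , 0 , 0) , 58) ∷
          (+ 2 , (0 , 0 , 0) , 84) ∷ (+ 1 , (0 , 0 , 0) , 83) ∷ (+ 2 , (0 , 0 , 0) , 43) ∷ [])
  ∷ (13 , (+ 1 , 4 , 6 , 3) ∷ []
        , (+ 1 , (1 , 4 , 3) , 3) ∷ (+ 3 , (0 , 0 , 0) , 68) ∷ (+ 1 , (0 , 0 , 0) , 86) ∷ (+ 2 , (0 , 0 , 0) , 59) ∷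
          (+ 2 , (0 , 0 , 0) , 85) ∷ (+ 1 , (0 , 0 , 0) , 84) ∷ (+ 2 , (0 , 0 , 0) , 44) ∷ [])
  ∷ (13 , (+ 1 , 5 , 5 , 3) ∷ []
        , (+ 1 , (0 , 5 , 3) , 4) ∷ (+ 3 , (0 , 0 , 0) , 87) ∷ (+ 4 , (0 , 0 , 0) , 86) ∷ (+ 1 , (0 , 0 , 0) , 85) ∷
          (+ 1 , (0 , 0 , 0) , 83) ∷ [])
  ∷ (13 , (+ 1 , 6 , 4 , 3) ∷ []
        , (+ 1 , (1 , 4 , 3) , 4) ∷ (+ 3 , (0 , 0 , 0) , 88) ∷ (+ 4 , (0 , 0 , 0) , 87) ∷ (+ 1 , (0 , 0 , 0) , 86) ∷
          (+ 1 , (0 , 0 , 0) , 84) ∷ [])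
  ∷ (13 , (+ 1 , 7 , 3 , 3) ∷ []
        , (+ 1 , (2 , 3 , 3) , 4) ∷ (+ 3 , (0 , 0 , 0) , 89) ∷ (+ 4 , (0 , 0 , 0) , 88) ∷ (+ 1 , (0 , 0 , 0) , 87) ∷
          (+ 1 , (0 , 0 , 0) , 85) ∷ [])
  ∷ (13 , (+ 1 , 8 , 2 , 3) ∷ []
        , (+ 1 , (3 , 2 , 3) , 4) ∷ (+ 3 , (0 , 0 , 0) , 90) ∷ (+ 4 , (0 , 0 , 0) , 89) ∷ (+ 1 , (0 , 0 , 0) , 88) ∷
          (+ 1 , (0 , 0 , 0) , 86) ∷ [])
  ∷ (13 , (+ 1 , 9 , 1 , 3) ∷ []
        , (+ 1 , (4 , 1 , 3) , 4) ∷ (+ 3 , (0 , 0 , 0) , 91) ∷ (+ 4 , (0 , 0 , 0) , 90) ∷ (+ 1 , (0 , 0 , 0) , 89) ∷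
          (+ 1 , (0 , 0 , 0) , 87) ∷ [])
  ∷ (13 , (+ 1 , 10 , 0 , 3) ∷ []
        , (+ 1 , (5 , 0 , 3) , 4) ∷ (+ 3 , (0 , 0 , 0) , 92) ∷ (+ 4 , (0 , 0 , 0) , 91) ∷ (+ 1 , (0 , 0 , 0) , 90) ∷
          (+ 1 , (0 , 0 , 0) , 88) ∷ [])
  ∷ (13 , (+ 1 , 0 , 11 , 2) ∷ []
        , (+ 1 , (0 , 4 , 2) , 9) ∷ (+ 2 , (0 , 0 , 0) , 77) ∷ (+ 2 , (0 , 0 , 0) , 67) ∷ (+ 2 , (0 , 0 , 0) , 87) ∷
          (+ 4 , (0 , 0 , 0) , 76) ∷ (+ 4 , (0 , 0 , 0) , 49) ∷ (+ 2 , (0 , 0 , 0) , 66) ∷ (+ 2 , (0 , 0 , 0) , 89) ∷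
          (+ 3 , (0 , 0 , 0) , 51) ∷ (+ 1 , (0 , 0 , 0) , 68) ∷ (+ 3 , (0 , 0 , 0) , 88) ∷ [])
  ∷ (13 , (+ 1 , 1 , 10 , 2) ∷ []
        , (+ 1 , (0 , 5 , 2) , 7) ∷ (+ 1 , (0 , 0 , 0) , 94) ∷ (+ 3 , (0 , 0 , 0) , 88) ∷ (+ 2 , (0 , 0 , 0) , 50) ∷
          (+ 4 , (0 , 0 , 0) , 67) ∷ (+ 2 , (0 , 0 , 0) , 76) ∷ (+ 3 , (0 , 0 , 0) , 66) ∷ (+ 3 , (0 , 0 , 0) , 49) ∷ [])
  ∷ (13 , (+ 1 , 2 , 9 , 2) ∷ []
        , (+ 1 , (1 , 4 , 2) , 7) ∷ (+ 1 , (0 , 0 , 0) , 95) ∷ (+ 3 , (0 , 0 , 0) , 89) ∷ (+ 2 , (0 , 0 , 0) , 51) ∷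
          (+ 4 , (0 , 0 , 0) , 68) ∷ (+ 2 , (0 , 0 , 0) , 77) ∷ (+ 3 , (0 , 0 , 0) , 67) ∷ (+ 3 , (0 , 0 , 0) , 50) ∷ [])
  ∷ (13 , (+ 1 , 3 , 8 , 2) ∷ []
        , (+ 1 , (0 , 6 , 2) , 3) ∷ (+ 3 , (0 , 0 , 0) , 76) ∷ (+ 1 , (0 , 0 , 0) , 96) ∷ (+ 2 , (0 , 0 , 0) , 66) ∷
          (+ 2 , (0 , 0 , 0) , 95) ∷ (+ 1 , (0 , 0 , 0) , 94) ∷ (+ 2 , (0 , 0 , 0) , 49) ∷ [])
  ∷ (13 , (+ 1 , 4 , 7 , 2) ∷ []
        , (+ 1 , (1 , 5 , 2) , 3) ∷ (+ 3 , (0 , 0 , 0) , 77) ∷ (+ 1 , (0 , 0 , 0) , 97) ∷ (+ 2 , (0 , 0 , 0) , 67) ∷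
          (+ 2 , (0 , 0 , 0) , 96) ∷ (+ 1 , (0 , 0 , 0) , 95) ∷ (+ 2 , (0 , 0 , 0) , 50) ∷ [])
  ∷ (13 , (+ 1 , 5 , 6 , 2) ∷ []
        , (+ 1 , (0 , 6 , 2) , 4) ∷ (+ 3 , (0 , 0 , 0) , 98) ∷ (+ 4 , (0 , 0 , 0) , 97) ∷ (+ 1 , (0 , 0 , 0) , 96) ∷
          (+ 1 , (0 , 0 , 0) , 94) ∷ [])
  ∷ (13 , (+ 1 , 6 , 5 , 2) ∷ []
        , (+ 1 , (1 , 5 , 2) , 4) ∷ (+ 3 , (0 , 0 , 0) , 99) ∷ (+ 4 , (0 , 0 , 0) , 98) ∷ (+ 1 , (0 , 0 , 0) , 97) ∷
          (+ 1 , (0 , 0 , 0) , 95) ∷ [])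
  ∷ (13 , (+ 1 , 7 , 4 , 2) ∷ []
        , (+ 1 , (2 , 4 , 2) , 4) ∷ (+ 3 , (0 , 0 , 0) , 100) ∷ (+ 4 , (0 , 0 , 0) , 99) ∷ (+ 1 , (0 , 0 , 0) , 98) ∷
          (+ 1 , (0 , 0 , 0) , 96) ∷ [])
  ∷ (13 , (+ 1 , 8 , 3 , 2) ∷ []
        , (+ 1 , (3 , 3 , 2) , 4) ∷ (+ 3 , (0 , 0 , 0) , 101) ∷ (+ 4 , (0 , 0 , 0) , 100) ∷ (+ 1 , (0 , 0 , 0) , 99) ∷
          (+ 1 , (0 , 0 , 0) , 97) ∷ [])
  ∷ (13 , (+ 1 , 9 , 2 , 2) ∷ []
        , (+ 1 , (4 , 2 , 2) , 4) ∷ (+ 3 , (0 , 0 , 0) , 102) ∷ (+ 4 , (0 , 0 , 0) , 101) ∷ (+ 1 , (0 , 0 , 0) , 100) ∷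
          (+ 1 , (0 , 0 , 0) , 98) ∷ [])
  ∷ (13 , (+ 1 , 10 , 1 , 2) ∷ []
        , (+ 1 , (5 , 1 , 2) , 4) ∷ (+ 3 , (0 , 0 , 0) , 103) ∷ (+ 4 , (0 , 0 , 0) , 102) ∷ (+ 1 , (0 , 0 , 0) , 101) ∷
          (+ 1 , (0 , 0 , 0) , 99) ∷ [])
  ∷ (13 , (+ 1 , 11 , 0 , 2) ∷ []
        , (+ 1 , (6 , 0 , 2) , 4) ∷ (+ 3 , (0 , 0 , 0) , 104) ∷ (+ 4 , (0 , 0 , 0) , 103) ∷ (+ 1 , (0 , 0 , 0) , 102) ∷
          (+ 1 , (0 , 0 , 0) , 100) ∷ [])
  ∷ (13 , (+ 1 , 0 , 12 , 1) ∷ []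
        , (+ 1 , (0 , 5 , 1) , 9) ∷ (+ 2 , (0 , 0 , 0) , 87) ∷ (+ 2 , (0 , 0 , 0) , 76) ∷ (+ 2 , (0 , 0 , 0) , 98) ∷
          (+ 4 , (0 , 0 , 0) , 86) ∷ (+ 4 , (0 , 0 , 0) , 56) ∷ (+ 2 , (0 , 0 , 0) , 75) ∷ (+ 2 , (0 , 0 , 0) , 100) ∷
          (+ 3 , (0 , 0 , 0) , 58) ∷ (+ 1 , (0 , 0 , 0) , 77) ∷ (+ 3 , (0 , 0 , 0) , 99) ∷ [])
  ∷ (13 , (+ 1 , 1 , 11 , 1) ∷ []
        , (+ 1 , (0 , 6 , 1) , 7) ∷ (+ 1 , (0 , 0 , 0) , 106) ∷ (+ 3 , (0 , 0 , 0) , 99) ∷ (+ 2 , (0 , 0 , 0) , 57) ∷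
          (+ 4 , (0 , 0 , 0) , 76) ∷ (+ 2 , (0 , 0 , 0) , 86) ∷ (+ 3 , (0 , 0 , 0) , 75) ∷ (+ 3 , (0 , 0 , 0) , 56) ∷ [])
  ∷ (13 , (+ 1 , 2 , 10 , 1) ∷ []
        , (+ 1 , (1 , 5 , 1) , 7) ∷ (+ 1 , (0 , 0 , 0) , 107) ∷ (+ 3 , (0 , 0 , 0) , 100) ∷ (+ 2 , (0 , 0 , 0) , 58) ∷
          (+ 4 , (0 , 0 , 0) , 77) ∷ (+ 2 , (0 , 0 , 0) , 87) ∷ (+ 3 , (0 , 0 , 0) , 76) ∷ (+ 3 , (0 , 0 , 0) , 57) ∷ [])
  ∷ (13 , (+ 1 , 3 , 9 , 1) ∷ []
        , (+ 1 , (0 , 7 , 1) , 3) ∷ (+ 3 , (0 , 0 , 0) , 86) ∷ (+ 1 , (0 , 0 , 0) , 108) ∷ (+ 2 , (0 , 0 , 0) , 75) ∷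
          (+ 2 , (0 , 0 , 0) , 107) ∷ (+ 1 , (0 , 0 , 0) , 106) ∷ (+ 2 , (0 , 0 , 0) , 56) ∷ [])
  ∷ (13 , (+ 1 , 4 , 8 , 1) ∷ []
        , (+ 1 , (1 , 6 , 1) , 3) ∷ (+ 3 , (0 , 0 , 0) , 87) ∷ (+ 1 , (0 , 0 , 0) , 109) ∷ (+ 2 , (0 , 0 , 0) , 76) ∷
          (+ 2 , (0 , 0 , 0) , 108) ∷ (+ 1 , (0 , 0 , 0) , 107) ∷ (+ 2 , (0 , 0 , 0) , 57) ∷ [])
  ∷ (13 , (+ 1 , 5 , 7 , 1) ∷ []
        , (+ 1 , (0 , 7 , 1) , 4) ∷ (+ 3 , (0 , 0 , 0) , 110) ∷ (+ 4 , (0 , 0 , 0) , 109) ∷ (+ 1 , (0 , 0 , 0) , 108) ∷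
          (+ 1 , (0 , 0 , 0) , 106) ∷ [])
  ∷ (13 , (+ 1 , 6 , 6 , 1) ∷ []
        , (+ 1 , (1 , 6 , 1) , 4) ∷ (+ 3 , (0 , 0 , 0) , 111) ∷ (+ 4 , (0 , 0 , 0) , 110) ∷ (+ 1 , (0 , 0 , 0) , 109) ∷
          (+ 1 , (0 , 0 , 0) , 107) ∷ [])
  ∷ (13 , (+ 1 , 7 , 5 , 1) ∷ []
        , (+ 1 , (2 , 5 , 1) , 4) ∷ (+ 3 , (0 , 0 , 0) , 112) ∷ (+ 4 , (0 , 0 , 0) , 111) ∷ (+ 1 , (0 , 0 , 0) , 110) ∷
          (+ 1 , (0 , 0 , 0) , 108) ∷ [])
  ∷ (13 , (+ 1 , 8 , 4 , 1) ∷ []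
        , (+ 1 , (3 , 4 , 1) , 4) ∷ (+ 3 , (0 , 0 , 0) , 113) ∷ (+ 4 , (0 , 0 , 0) , 112) ∷ (+ 1 , (0 , 0 , 0) , 111) ∷
          (+ 1 , (0 , 0 , 0) , 109) ∷ [])
  ∷ (13 , (+ 1 , 9 , 3 , 1) ∷ []
        , (+ 1 , (4 , 3 , 1) , 4) ∷ (+ 3 , (0 , 0 , 0) , 114) ∷ (+ 4 , (0 , 0 , 0) , 113) ∷ (+ 1 , (0 , 0 , 0) , 112) ∷
          (+ 1 , (0 , 0 , 0) , 110) ∷ [])
  ∷ (13 , (+ 1 , 10 , 2 , 1) ∷ []
        , (+ 1 , (5 , 2 , 1) , 4) ∷ (+ 3 , (0 , 0 , 0) , 115) ∷ (+ 4 , (0 , 0 , 0) , 114) ∷ (+ 1 , (0 , 0 , 0) , 113) ∷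
          (+ 1 , (0 , 0 , 0) , 111) ∷ [])
  ∷ (13 , (+ 1 , 11 , 1 , 1) ∷ []
        , (+ 1 , (6 , 1 , 1) , 4) ∷ (+ 3 , (0 , 0 , 0) , 116) ∷ (+ 4 , (0 , 0 , 0) , 115) ∷ (+ 1 , (0 , 0 , 0) , 114) ∷
          (+ 1 , (0 , 0 , 0) , 112) ∷ [])
  ∷ (13 , (+ 1 , 12 , 0 , 1) ∷ []
        , (+ 1 , (7 , 0 , 1) , 4) ∷ (+ 3 , (0 , 0 , 0) , 117) ∷ (+ 4 , (0 , 0 , 0) , 116) ∷ (+ 1 , (0 , 0 , 0) , 115) ∷
          (+ 1 , (0 , 0 , 0) , 113) ∷ [])
  ∷ (13 , (+ 1 , 0 , 13 , 0) ∷ []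
        , (+ 1 , (0 , 6 , 0) , 9) ∷ (+ 2 , (0 , 0 , 0) , 98) ∷ (+ 2 , (0 , 0 , 0) , 86) ∷ (+ 2 , (0 , 0 , 0) , 110) ∷
          (+ 4 , (0 , 0 , 0) , 97) ∷ (+ 4 , (0 , 0 , 0) , 64) ∷ (+ 2 , (0 , 0 , 0) , 85) ∷ (+ 2 , (0 , 0 , 0) , 112) ∷
          (+ 3 , (0 , 0 , 0) , 66) ∷ (+ 1 , (0 , 0 , 0) , 87) ∷ (+ 3 , (0 , 0 , 0) , 111) ∷ [])
  ∷ (13 , (+ 1 , 1 , 12 , 0) ∷ []
        , (+ 1 , (0 , 7 , 0) , 7) ∷ (+ 1 , (0 , 0 , 0) , 119) ∷ (+ 3 , (0 , 0 , 0) , 111) ∷ (+ 2 , (0 , 0 , 0) , 65) ∷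
          (+ 4 , (0 , 0 , 0) , 86) ∷ (+ 2 , (0 , 0 , 0) , 97) ∷ (+ 3 , (0 , 0 , 0) , 85) ∷ (+ 3 , (0 , 0 , 0) , 64) ∷ [])
  ∷ (13 , (+ 1 , 2 , 11 , 0) ∷ []
        , (+ 1 , (1 , 6 , 0) , 7) ∷ (+ 1 , (0 , 0 , 0) , 120) ∷ (+ 3 , (0 , 0 , 0) , 112) ∷ (+ 2 , (0 , 0 , 0) , 66) ∷
          (+ 4 , (0 , 0 , 0) , 87) ∷ (+ 2 , (0 , 0 , 0) , 98) ∷ (+ 3 , (0 , 0 , 0) , 86) ∷ (+ 3 , (0 , 0 , 0) , 65) ∷ [])
  ∷ (13 , (+ 1 , 3 , 10 , 0) ∷ []
        , (+ 1 , (0 , 8 , 0) , 3) ∷ (+ 3 , (0 , 0 , 0) , 97) ∷ (+ 1 , (0 , 0 , 0) , 121) ∷ (+ 2 , (0 , 0 , 0) , 85) ∷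
          (+ 2 , (0 , 0 , 0) , 120) ∷ (+ 1 , (0 , 0 , 0) , 119) ∷ (+ 2 , (0 , 0 , 0) , 64) ∷ [])
  ∷ (13 , (+ 1 , 4 , 9 , 0) ∷ []
        , (+ 1 , (1 , 7 , 0) , 3) ∷ (+ 3 , (0 , 0 , 0) , 98) ∷ (+ 1 , (0 , 0 , 0) , 122) ∷ (+ 2 , (0 , 0 , 0) , 86) ∷
          (+ 2 , (0 , 0 , 0) , 121) ∷ (+ 1 , (0 , 0 , 0) , 120) ∷ (+ 2 , (0 , 0 , 0) , 65) ∷ [])
  ∷ (13 , (+ 1 , 5 , 8 , 0) ∷ []
        , (+ 1 , (0 , 8 , 0) , 4) ∷ (+ 3 , (0 , 0 , 0) , 123) ∷ (+ 4 , (0 , 0 , 0) , 122) ∷ (+ 1 , (0 , 0 , 0) , 121) ∷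
          (+ 1 , (0 , 0 , 0) , 119) ∷ [])
  ∷ (13 , (+ 1 , 6 , 7 , 0) ∷ []
        , (+ 1 , (1 , 7 , 0) , 4) ∷ (+ 3 , (0 , 0 , 0) , 124) ∷ (+ 4 , (0 , 0 , 0) , 123) ∷ (+ 1 , (0 , 0 , 0) , 122) ∷
          (+ 1 , (0 , 0 , 0) , 120) ∷ [])
  ∷ (13 , (+ 1 , 7 , 6 , 0) ∷ []
        , (+ 1 , (2 , 6 , 0) , 4) ∷ (+ 3 , (0 , 0 , 0) , 125) ∷ (+ 4 , (0 , 0 , 0) , 124) ∷ (+ 1 , (0 , 0 , 0) , 123) ∷
          (+ 1 , (0 , 0 , 0) , 121) ∷ [])
  ∷ (13 , (+ 1 , 8 , 5 , 0) ∷ []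
        , (+ 1 , (3 , 5 , 0) , 4) ∷ (+ 3 , (0 , 0 , 0) , 126) ∷ (+ 4 , (0 , 0 , 0) , 125) ∷ (+ 1 , (0 , 0 , 0) , 124) ∷
          (+ 1 , (0 , 0 , 0) , 122) ∷ [])
  ∷ (13 , (+ 1 , 9 , 4 , 0) ∷ []
        , (+ 1 , (4 , 4 , 0) , 4) ∷ (+ 3 , (0 , 0 , 0) , 127) ∷ (+ 4 , (0 , 0 , 0) , 126) ∷ (+ 1 , (0 , 0 , 0) , 125) ∷
          (+ 1 , (0 , 0 , 0) , 123) ∷ [])
  ∷ (13 , (+ 1 , 10 , 3 , 0) ∷ []
        , (+ 1 , (5 , 3 , 0) , 4) ∷ (+ 3 , (0 , 0 , 0) , 128) ∷ (+ 4 , (0 , 0 , 0) , 127) ∷ (+ 1 , (0 , 0 , 0) , 126) ∷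
          (+ 1 , (0 , 0 , 0) , 124) ∷ [])
  ∷ (13 , (+ 1 , 11 , 2 , 0) ∷ []
        , (+ 1 , (6 , 2 , 0) , 4) ∷ (+ 3 , (0 , 0 , 0) , 129) ∷ (+ 4 , (0 , 0 , 0) , 128) ∷ (+ 1 , (0 , 0 , 0) , 127) ∷
          (+ 1 , (0 , 0 , 0) , 125) ∷ [])
  ∷ (13 , (+ 1 , 12 , 1 , 0) ∷ []
        , (+ 1 , (7 , 1 , 0) , 4) ∷ (+ 3 , (0 , 0 , 0) , 130) ∷ (+ 4 , (0 , 0 , 0) , 129) ∷ (+ 1 , (0 , 0 , 0) , 128) ∷
          (+ 1 , (0 , 0 , 0) , 126) ∷ [])
  ∷ (13 , (+ 1 , 13 , 0 , 0) ∷ []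
        , (+ 1 , (8 , 0 , 0) , 4) ∷ (+ 3 , (0 , 0 , 0) , 131) ∷ (+ 4 , (0 , 0 , 0) , 130) ∷ (+ 1 , (0 , 0 , 0) , 129) ∷
          (+ 1 , (0 , 0 , 0) , 127) ∷ [])
  ∷ []

proposition5p1 : (h : Poly) → IsHomogeneous 6 h →
    IsK3Degree2 (+ 73) (+ 7 ⋆ (F₀ ⊕ (+ 15 ⋆ h)))
proposition5p1 h h-hom = (λ ()) , homogeneous , ≡.subst SmoothPlaneCurve (≡.sym split) smooth
  where
  r : Poly
  r = + 73 ⋆ (+ 7 ⋆ (+ 15 ⋆ h))
  homogeneous : IsHomogeneous 6 (+ 73 ⋆ (+ 7 ⋆ (F₀ ⊕ (+ 15 ⋆ h))))
  homogeneous = ⋆-homogeneous (+ 73) (⋆-homogeneous (+ 7) (All.++⁺ F₀-homogeneous (⋆-homogeneous (+ 15) h-hom)))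
  split : + 73 ⋆ (+ 7 ⋆ (F₀ ⊕ (+ 15 ⋆ h))) ≡ F₀′ ⊕ r
  split = ≡.trans (≡.cong (λ f → + 73 ⋆ f) (List.map-++ _ F₀ (+ 15 ⋆ h))) (List.map-++ _ (+ 7 ⋆ F₀) _)
  r-divisible : Divisible 5 6 r
  r-divisible = ⋆-preserves-divisible (+ 73) (⋆-preserves-divisible (+ 7) (⋆-divisible (divides (+ 3) ≡.refl) h-hom))
  smooth : SmoothPlaneCurve (F₀′ ⊕ r)
  smooth = certified⇒smooth 5 5 13 F₀′ r F₀-certificate (λ ())
    (∂x-divisible r-divisible) (∂y-divisible r-divisible) (∂z-divisible r-divisible) tt
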